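{- Let $\mathcal{P}re$ be the set of preorders on $SC$, ordered by inclusion. The map $\Phi:\mathcal{P}re\to\mathcal{P}re$, $\Phi(\mathcal{B})=\sqsubseteq^{\mathcal{B}}_{\mathrm{peer}}$, is a well-defined monotone endofunction: for every preorder $\mathcal{B}$, $\sqsubseteq^{\mathcal{B}}_{\mathrm{peer}}$ is a preorder, and $\mathcal{B}\subseteq\mathcal{B}'$ implies $\sqsubseteq^{\mathcal{B}}_{\mathrm{peer}}\subseteq\sqsubseteq^{\mathcal{B}'}_{\mathrm{peer}}$.
   Context: Fix a set $BT$ of base types with a preorder $\le_:$ and a countable set of labels. Contract terms: $\sigma ::= \mathbf{1} \mid ?t.\sigma \mid !t.\sigma \mid ?(\sigma').\sigma \mid !(\sigma').\sigma \mid \sum_{i\in I} ?l_i.\sigma_i \mid \bigoplus_{i\in I} !l_i.\sigma_i \mid \mu x.\sigma \mid x$ ($t\in BT$, $I$ finite nonempty, labels pairwise distinct; $!l.\sigma$ is the one-summand internal sum). A term is guarded if for every subterm $\mu x.\sigma$, every occurrence of $x$ in $\sigma$ lies under a constructor other than $\mu$; $SC$ is the set of closed guarded terms. Actions: $\mathsf{Act}=\{?l,!l\}\cup\{?t,!t\}\cup\{?(\sigma),!(\sigma):\sigma\in SC\}$. Transitions: $\mathbf{1}\xrightarrow{\mathsf{ok}}$; $\lambda.\sigma\xrightarrow{\lambda}\sigma$ for a prefix $\lambda\in\mathsf{Act}$; $\sum_{i\in I}?l_i.\sigma_i\xrightarrow{?l_k}\sigma_k$; $\bigoplus_{i\in I}!l_i.\sigma_i\xrightarrow{\tau}!l_k.\sigma_k$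 when $|I|>1$; $\mu x.\sigma\xrightarrow{\tau}\sigma\{\mu x.\sigma/x\}$; nothing else. For a binary relation $\mathcal{B}$ on $SC$: $\lambda_1\bowtie_{\mathcal{B}}\lambda_2$ iff $(\lambda_1,\lambda_2)$ is $(!l,?l)$, $(?l,!l)$, $(!t_1,?t_2)$ with $t_1\le_:t_2$, $(?t_1,!t_2)$ with $t_2\le_:t_1$, $(!(\sigma_1),?(\sigma_2))$ with $\sigma_1\mathcal{B}\sigma_2$, or $(?(\sigma_1),!(\sigma_2))$ with $\sigma_2\mathcal{B}\sigma_1$. $\rho\mid\sigma\xrightarrow{\tau}_{\mathcal{B}}\rho'\mid\sigma'$ iff $\rho\xrightarrow{\tau}\rho'$, $\sigma'=\sigma$; or $\sigma\xrightarrow{\tau}\sigma'$, $\rho'=\rho$; or $\rho\xrightarrow{\lambda_1}\rho'$, $\sigma\xrightarrow{\lambda_2}\sigma'$, $\lambda_1\bowtie_{\mathcal{B}}\lambda_2$. $\models_{\mathcal{B}}$ is the largest relation $R$ on $SC$ such that whenever $\rho R\sigma$: (i) if $\rho\mid\sigma$ has no $\tau$-transition w.r.t. $\mathcal{B}$ then $\rho\xrightarrow{\mathsf{ok}}$, $\sigma\xrightarrow{\mathsf{ok}}$; (ii) $\rho\mid\sigma\xrightarrow{\tau}_{\mathcal{B}}\rho'\mid\sigma'$ implies $\rho'R\sigma'$. $\sigma_1\sqsubseteq^{\mathcal{B}}_{\mathrm{peer}}\sigma_2$ iff for all $\rho\in SC$, $\rho\models_{\mathcal{B}}\sigma_1$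 implies $\rho\models_{\mathcal{B}}\sigma_2$. -}

module Defs where

open import Data.Nat using (ℕ; _≡ᵇ_)
open import Data.Bool using (Bool; true; false; _∧_; _∨_; not; if_then_else_; T)
open import Data.List using (List; []; _∷_; map)
open import Data.List.Membership.Propositional using (_∈_)
open import Data.Product using (Σ; _×_; _,_; proj₁)
open import Data.Empty using (⊥)
open import Relation.Nullary using (¬_)
open import Level using (0ℓ; suc)
open import Relation.Binary.Core using (Rel)

Label : Set
Label = ℕ

Var : Set
Var = ℕ

module Contracts (BT : Set) (_≤:_ : BT → BT → Set) where

  -- Raw contract terms.  A sum  Σ_{i∈I} ?l_i.σ_i  is represented by its
  -- first summand and the list of the remaining ones (so I is nonempty).
  data Term : Set where
    𝟏    : Term
    ?b_·_ : BT → Term → Term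
    !b_·_ : BT → Term → Term
    ?h_·_ : Term → Term → Term
    !h_·_ : Term → Term → Term
    ext  : Label → Term → List (Label × Term) → Term
    int  : Label → Term → List (Label × Term) → Term
    μ    : Var → Term → Term
    var  : Var → Term

  elemᵇ : ℕ → List ℕ → Bool
  elemᵇ x []       = false
  elemᵇ x (y ∷ ys) = (x ≡ᵇ y) ∨ elemᵇ x ys

  mutual
    closedIn : List Var → Term → Bool
    closedIn bs 𝟏 = true
    closedIn bs (?b t · s) = closedIn bs s
    closedIn bs (!b t · s) = closedIn bs s
    closedIn bs (?h s' · s) = closedIn bs s' ∧ closedIn bs s
    closedIn bs (!h s' · s) = closedIn bs s' ∧ closedIn bs s
    closedIn bs (ext l s ls) = closedIn bs s ∧ closedInL bs ls
    closedIn bs (int l s ls) = closedIn bs s ∧ closedInL bs ls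
    closedIn bs (μ x s) = closedIn (x ∷ bs) s
    closedIn bs (var x) = elemᵇ x bs

    closedInL : List Var → List (Label × Term) → Bool
    closedInL bs [] = true
    closedInL bs ((l , s) ∷ ls) = closedIn bs s ∧ closedInL bs ls

  unguardedOcc : Var → Term → Bool
  unguardedOcc x (var y) = x ≡ᵇ y
  unguardedOcc x (μ y s) = if x ≡ᵇ y then false else unguardedOcc x s
  unguardedOcc x _ = false

  distinct : List Label → Bool
  distinct [] = true
  distinct (l ∷ ls) = not (elemᵇ l ls) ∧ distinct ls

  labels : Label → List (Label × Term) → List Label
  labels l ls = l ∷ map proj₁ ls

  mutual
    wf : Term → Bool
    wf 𝟏 = true
    wf (?b t · s) = wf s
    wf (!b t · s) = wf s
    wf (?h s' · s) = wf s' ∧ wf s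
    wf (!h s' · s) = wf s' ∧ wf s
    wf (ext l s ls) = distinct (labels l ls) ∧ (wf s ∧ wfL ls)
    wf (int l s ls) = distinct (labels l ls) ∧ (wf s ∧ wfL ls)
    wf (μ x s) = not (unguardedOcc x s) ∧ wf s
    wf (var x) = true

    wfL : List (Label × Term) → Bool
    wfL [] = true
    wfL ((l , s) ∷ ls) = wf s ∧ wfL ls

  isSC : Term → Bool
  isSC s = closedIn [] s ∧ wf s

  SC : Set
  SC = Σ Term (λ s → T (isSC s))

  term : SC → Term
  term = proj₁

  -- substitution  s{u/x}  (used only with u closed, so no capture)
  mutual
    subst : Term → Var → Term → Term
    subst 𝟏 x u = 𝟏
    subst (?b t · s) x u = ?b t · subst s x u
    subst (!b t · s) x u = !b t · subst s x u
    subst (?h s' · s) x u = ?h subst s' x u · subst s x u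
    subst (!h s' · s) x u = !h subst s' x u · subst s x u
    subst (ext l s ls) x u = ext l (subst s x u) (substL ls x u)
    subst (int l s ls) x u = int l (subst s x u) (substL ls x u)
    subst (μ y s) x u = if x ≡ᵇ y then μ y s else μ y (subst s x u)
    subst (var y) x u = if x ≡ᵇ y then u else var y

    substL : List (Label × Term) → Var → Term → List (Label × Term)
    substL [] x u = []
    substL ((l , s) ∷ ls) x u = (l , subst s x u) ∷ substL ls x u

  data Act : Set where
    ?l !l : Label → Act
    ?t !t : BT → Act
    ?σ !σ : SC → Act

  data Lbl : Set where
    τ   : Lbl
    act : Act → Lbl

  data Ok : Term → Set where
    ok-𝟏 : Ok 𝟏

  data _—[_]→_ : Term → Lbl → Term → Set where
    pre-?t : ∀ {t s} → (?b t · s) —[ act (?t t) ]→ s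
    pre-!t : ∀ {t s} → (!b t · s) —[ act (!t t) ]→ s
    pre-?σ : ∀ {s' s} (p : T (isSC s')) → (?h s' · s) —[ act (?σ (s' , p)) ]→ s
    pre-!σ : ∀ {s' s} (p : T (isSC s')) → (!h s' · s) —[ act (!σ (s' , p)) ]→ s
    pre-!l : ∀ {l s} → int l s [] —[ act (!l l) ]→ s
    ext-?l : ∀ {l s ls k sk} → (k , sk) ∈ ((l , s) ∷ ls) → ext l s ls —[ act (?l k) ]→ sk
    int-τ  : ∀ {l s p ps k sk} → (k , sk) ∈ ((l , s) ∷ p ∷ ps) →
             int l s (p ∷ ps) —[ τ ]→ int k sk []
    rec-τ  : ∀ {x s} → μ x s —[ τ ]→ subst s x (μ x s)

  module WithB (B : Rel SC 0ℓ) where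

    data _⋈_ : Act → Act → Set where
      ⋈-!? : ∀ {l} → !l l ⋈ ?l l
      ⋈-?! : ∀ {l} → ?l l ⋈ !l l
      ⋈-!?t : ∀ {t₁ t₂} → t₁ ≤: t₂ → !t t₁ ⋈ ?t t₂
      ⋈-?!t : ∀ {t₁ t₂} → t₂ ≤: t₁ → ?t t₁ ⋈ !t t₂
      ⋈-!?σ : ∀ {σ₁ σ₂} → B σ₁ σ₂ → !σ σ₁ ⋈ ?σ σ₂
      ⋈-?!σ : ∀ {σ₁ σ₂} → B σ₂ σ₁ → ?σ σ₁ ⋈ !σ σ₂

    data Step : Term → Term → Term → Term → Set where
      left  : ∀ {ρ ρ' σ} → ρ —[ τ ]→ ρ' → Step ρ σ ρ' σ
      right : ∀ {ρ σ σ'} → σ —[ τ ]→ σ' → Step ρ σ ρ σ'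
      sync  : ∀ {ρ ρ' σ σ' λ₁ λ₂} → ρ —[ act λ₁ ]→ ρ' → σ —[ act λ₂ ]→ σ' →
              λ₁ ⋈ λ₂ → Step ρ σ ρ' σ'

    Stuck : Term → Term → Set
    Stuck ρ σ = ∀ ρ' σ' → ¬ Step ρ σ ρ' σ'

    IsCompliance : Rel SC 0ℓ → Set
    IsCompliance R = ∀ ρ σ → R ρ σ →
      (Stuck (term ρ) (term σ) → Ok (term ρ) × Ok (term σ)) ×
      (∀ ρ' σ' → Step (term ρ) (term σ) (term ρ') (term σ') → R ρ' σ')

    -- ⊨_B : the largest compliance relation (union of all of them)
    _⊨_ : SC → SC → Set₁
    ρ ⊨ σ = Σ (Rel SC 0ℓ) (λ R → IsCompliance R × R ρ σ)

    _⊑peer_ : SC → SC → Set₁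
    σ₁ ⊑peer σ₂ = ∀ ρ → ρ ⊨ σ₁ → ρ ⊨ σ₂

  Peer : Rel SC 0ℓ → Rel SC (suc 0ℓ)
  Peer B = WithB._⊑peer_ B

-- Reflexivity and transitivity of ⊑ᴮ_peer are inherited from implication.
--
-- For monotonicity let B ⊆ B′ and σ₁ ⊑ᴮ_peer σ₂.  We show that relating ρ to
-- σ₂ whenever ρ ⊨_B′ σ₁′ for some σ₁′ ⊑ᴮ_peer σ₂ defines a B′-compliance.
-- Compliance is the safety property "every reachable stuck configuration is
-- successful", and every contract σ has a dual that is B-compliant with it
-- (B and ≤: being reflexive).  After unfolding σ₁′, a case analysis on its
-- head builds tests out of duals -- a prefix co α.X, or an external sum
-- answering every branch of an internal choice -- which are B-compliant with
-- σ₁′ and hence with σ₂; they force σ₂ to offer a matching action and supply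
-- the next σ₁′.  Finally an action of ρ that is B′-compatible with α is
-- B′-compatible with every action of σ₂ that is B-compatible with co α, by
-- transitivity of ≤: and of B′.

module Submission where

open import Defs
open import Level using (0ℓ)
open import Data.Nat using (ℕ; suc; _≡ᵇ_; _≤_; s≤s)
open import Data.Nat.Properties using (≡ᵇ⇒≡; ≡⇒≡ᵇ; _≟_; ≤-refl)
open import Data.Bool using (true; false; _∧_; _∨_; not; if_then_else_; T)
open import Data.Bool.Properties using (T-irrelevant; T-≡)
open import Data.List using (List; []; _∷_; map)
open import Data.List.Membership.Propositional using (_∈_)
open import Data.List.Relation.Unary.Any using (here; there)
open import Data.List.Properties using (map-∘)
open import Data.List.Membership.Propositional.Properties using (∈-map⁺; ∈-map⁻)
open import Data.Product using (Σ; _×_; _,_; proj₁; proj₂)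
open import Data.Sum using (_⊎_; inj₁; inj₂)
open import Data.Unit using (⊤; tt)
open import Data.Empty using (⊥; ⊥-elim)
open import Function using (_∘_; Equivalence)
open import Relation.Nullary using (¬_; Dec; yes; no)
open import Relation.Nullary.Reflects using (Reflects; ofʸ; ofⁿ; fromEquivalence)
open import Relation.Binary.Core using (Rel; _⇒_)
open import Relation.Binary.Structures using (IsPreorder)
open import Relation.Binary.PropositionalEquality
  using (_≡_; _≢_; refl; sym; trans; cong; cong₂; _≗_; isEquivalence; module ≡-Reasoning)
  renaming (subst to transport)

≡ᵇ-reflects : ∀ m n → Reflects (m ≡ n) (m ≡ᵇ n)
≡ᵇ-reflects m n = fromEquivalence (≡ᵇ⇒≡ m n) (≡⇒≡ᵇ m n)

≡ᵇ-refl : ∀ n → (n ≡ᵇ n) ≡ true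
≡ᵇ-refl n with n ≡ᵇ n | ≡ᵇ-reflects n n
... | true  | _       = refl
... | false | ofⁿ n≢n = ⊥-elim (n≢n refl)

≢⇒≡ᵇ-false : ∀ {m n} → m ≢ n → (m ≡ᵇ n) ≡ false
≢⇒≡ᵇ-false {m} {n} m≢n with m ≡ᵇ n | ≡ᵇ-reflects m n
... | true  | ofʸ m≡n = ⊥-elim (m≢n m≡n)
... | false | _       = refl

∧-intro : ∀ {a b} → a ≡ true → b ≡ true → a ∧ b ≡ true
∧-intro refl refl = refl

∧-elimˡ : ∀ {a b} → a ∧ b ≡ true → a ≡ true
∧-elimˡ {true} _ = refl

∧-elimʳ : ∀ {a b} → a ∧ b ≡ true → b ≡ true
∧-elimʳ {true} b≡true = b≡true

∨-introˡ : ∀ {a b} → a ≡ true → a ∨ b ≡ true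
∨-introˡ refl = refl

∨-introʳ : ∀ {a b} → b ≡ true → a ∨ b ≡ true
∨-introʳ {true}  _      = refl
∨-introʳ {false} b≡true = b≡true

not-true : ∀ {a} → not a ≡ true → a ≢ true
not-true {true} ()

not-intro : ∀ {a} → a ≢ true → not a ≡ true
not-intro {true}  a≢true = ⊥-elim (a≢true refl)
not-intro {false} _      = refl

not-true⇒false : ∀ {a} → not a ≡ true → a ≡ false
not-true⇒false {false} _ = refl

∧-map-∧ : ∀ d {a b a′ b′} → (a ≡ true → a′ ≡ true) → (b ≡ true → b′ ≡ true) →
          d ∧ (a ∧ b) ≡ true → d ∧ (a′ ∧ b′) ≡ true
∧-map-∧ true f g h = ∧-intro (f (∧-elimˡ h)) (g (∧-elimʳ h))

module Syntax (BT : Set) (_≤:_ : BT → BT → Set) where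
  open Contracts BT _≤:_

  Env : Set
  Env = Var → Term

  _[_≔_] : Env → Var → Term → Env
  (ε [ x ≔ u ]) y = if y ≡ᵇ x then u else ε y

  -- Simultaneous substitution.  It does not avoid capture, which is harmless:
  -- every environment used maps each variable to itself or to a closed term.
  mutual
    close : Env → Term → Term
    close ε 𝟏            = 𝟏
    close ε (?b t · s)   = ?b t · close ε s
    close ε (!b t · s)   = !b t · close ε s
    close ε (?h p · s)   = ?h close ε p · close ε s
    close ε (!h p · s)   = !h close ε p · close ε s
    close ε (ext l s ls) = ext l (close ε s) (closeL ε ls)
    close ε (int l s ls) = int l (close ε s) (closeL ε ls)
    close ε (μ y s)      = μ y (close (ε [ y ≔ var y ]) s)
    close ε (var y)      = ε y

    closeL : Env → List (Label × Term) → List (Label × Term)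
    closeL ε []             = []
    closeL ε ((l , s) ∷ ls) = (l , close ε s) ∷ closeL ε ls

  [≔]-cong : ∀ {ε ε′ u u′} x → ε ≗ ε′ → u ≡ u′ → ε [ x ≔ u ] ≗ ε′ [ x ≔ u′ ]
  [≔]-cong x ε≗ε′ refl y with y ≡ᵇ x
  ... | true  = refl
  ... | false = ε≗ε′ y

  mutual
    close-cong : ∀ {ε ε′} t → ε ≗ ε′ → close ε t ≡ close ε′ t
    close-cong 𝟏            e = refl
    close-cong (?b t · s)   e = cong (?b t ·_) (close-cong s e)
    close-cong (!b t · s)   e = cong (!b t ·_) (close-cong s e)
    close-cong (?h p · s)   e = cong₂ ?h_·_ (close-cong p e) (close-cong s e)
    close-cong (!h p · s)   e = cong₂ !h_·_ (close-cong p e) (close-cong s e)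
    close-cong (ext l s ls) e = cong₂ (ext l) (close-cong s e) (closeL-cong ls e)
    close-cong (int l s ls) e = cong₂ (int l) (close-cong s e) (closeL-cong ls e)
    close-cong (μ y s)      e = cong (μ y) (close-cong s ([≔]-cong y e refl))
    close-cong (var y)      e = e y

    closeL-cong : ∀ {ε ε′} ls → ε ≗ ε′ → closeL ε ls ≡ closeL ε′ ls
    closeL-cong []             e = refl
    closeL-cong ((l , s) ∷ ls) e = cong₂ (λ a b → (l , a) ∷ b) (close-cong s e) (closeL-cong ls e)

  var[≔var] : ∀ y → var [ y ≔ var y ] ≗ var
  var[≔var] y z with z ≡ᵇ y | ≡ᵇ-reflects z y
  ... | true  | ofʸ refl = refl
  ... | false | _        = refl

  mutual
    close-var : ∀ t → close var t ≡ t
    close-var 𝟏            = refl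
    close-var (?b t · s)   = cong (?b t ·_) (close-var s)
    close-var (!b t · s)   = cong (!b t ·_) (close-var s)
    close-var (?h p · s)   = cong₂ ?h_·_ (close-var p) (close-var s)
    close-var (!h p · s)   = cong₂ !h_·_ (close-var p) (close-var s)
    close-var (ext l s ls) = cong₂ (ext l) (close-var s) (closeL-var ls)
    close-var (int l s ls) = cong₂ (int l) (close-var s) (closeL-var ls)
    close-var (μ y s)      = cong (μ y) (trans (close-cong s (var[≔var] y)) (close-var s))
    close-var (var y)      = refl

    closeL-var : ∀ ls → closeL var ls ≡ ls
    closeL-var []             = refl
    closeL-var ((l , s) ∷ ls) = cong₂ (λ a b → (l , a) ∷ b) (close-var s) (closeL-var ls)

  Closed : List Var → Term → Set
  Closed bs t = closedIn bs t ≡ true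

  ClosedL : List Var → List (Label × Term) → Set
  ClosedL bs ls = closedInL bs ls ≡ true

  _∈ᵇ_ : Var → List Var → Set
  y ∈ᵇ bs = elemᵇ y bs ≡ true

  ∈ᵇ-here : ∀ y bs → y ∈ᵇ (y ∷ bs)
  ∈ᵇ-here y bs rewrite ≡ᵇ-refl y = refl

  ∈ᵇ-there : ∀ {z} y bs → z ∈ᵇ bs → z ∈ᵇ (y ∷ bs)
  ∈ᵇ-there {z} y bs = ∨-introʳ {z ≡ᵇ y}

  ∈ᵇ-∷⁻ : ∀ {z y bs} → z ∈ᵇ (y ∷ bs) → z ≡ y ⊎ z ∈ᵇ bs
  ∈ᵇ-∷⁻ {z} {y} z∈ with z ≡ᵇ y | ≡ᵇ-reflects z y
  ... | true  | ofʸ z≡y = inj₁ z≡y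
  ... | false | _       = inj₂ z∈

  _⊆ᵇ_ : List Var → List Var → Set
  bs ⊆ᵇ bs′ = ∀ z → z ∈ᵇ bs → z ∈ᵇ bs′

  ⊆ᵇ-∷ : ∀ {bs bs′} y → bs ⊆ᵇ bs′ → (y ∷ bs) ⊆ᵇ (y ∷ bs′)
  ⊆ᵇ-∷ y bs⊆bs′ z z∈ with z ≡ᵇ y
  ... | true  = refl
  ... | false = bs⊆bs′ z z∈

  mutual
    Closed-weaken : ∀ {bs bs′} t → bs ⊆ᵇ bs′ → Closed bs t → Closed bs′ t
    Closed-weaken 𝟏            h c = refl
    Closed-weaken (?b t · s)   h c = Closed-weaken s h c
    Closed-weaken (!b t · s)   h c = Closed-weaken s h c
    Closed-weaken (?h p · s)   h c = ∧-intro (Closed-weaken p h (∧-elimˡ c)) (Closed-weaken s h (∧-elimʳ c))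
    Closed-weaken (!h p · s)   h c = ∧-intro (Closed-weaken p h (∧-elimˡ c)) (Closed-weaken s h (∧-elimʳ c))
    Closed-weaken (ext l s ls) h c = ∧-intro (Closed-weaken s h (∧-elimˡ c)) (ClosedL-weaken ls h (∧-elimʳ c))
    Closed-weaken (int l s ls) h c = ∧-intro (Closed-weaken s h (∧-elimˡ c)) (ClosedL-weaken ls h (∧-elimʳ c))
    Closed-weaken {bs} {bs′} (μ y s) h c = Closed-weaken s (⊆ᵇ-∷ {bs} {bs′} y h) c
    Closed-weaken (var y)      h c = h y c

    ClosedL-weaken : ∀ {bs bs′} ls → bs ⊆ᵇ bs′ → ClosedL bs ls → ClosedL bs′ ls
    ClosedL-weaken []             h c = refl
    ClosedL-weaken ((l , s) ∷ ls) h c = ∧-intro (Closed-weaken s h (∧-elimˡ c)) (ClosedL-weaken ls h (∧-elimʳ c))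

  Closed-weaken-∷ : ∀ {bs} y t → Closed bs t → Closed (y ∷ bs) t
  Closed-weaken-∷ {bs} y t = Closed-weaken t (λ z → ∈ᵇ-there y bs)

  AgreeOn : List Var → Env → Env → Set
  AgreeOn bs ε ε′ = ∀ y → y ∈ᵇ bs → ε y ≡ ε′ y

  AgreeOn-[≔] : ∀ {bs ε ε′ u u′} y → u ≡ u′ → AgreeOn bs ε ε′ →
                AgreeOn (y ∷ bs) (ε [ y ≔ u ]) (ε′ [ y ≔ u′ ])
  AgreeOn-[≔] y refl a z z∈ with z ≡ᵇ y
  ... | true  = refl
  ... | false = a z z∈

  mutual
    close-agree : ∀ {bs ε ε′} t → Closed bs t → AgreeOn bs ε ε′ → close ε t ≡ close ε′ t
    close-agree 𝟏            c a = refl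
    close-agree (?b t · s)   c a = cong (?b t ·_) (close-agree s c a)
    close-agree (!b t · s)   c a = cong (!b t ·_) (close-agree s c a)
    close-agree (?h p · s)   c a = cong₂ ?h_·_ (close-agree p (∧-elimˡ c) a) (close-agree s (∧-elimʳ c) a)
    close-agree (!h p · s)   c a = cong₂ !h_·_ (close-agree p (∧-elimˡ c) a) (close-agree s (∧-elimʳ c) a)
    close-agree (ext l s ls) c a = cong₂ (ext l) (close-agree s (∧-elimˡ c) a) (closeL-agree ls (∧-elimʳ c) a)
    close-agree (int l s ls) c a = cong₂ (int l) (close-agree s (∧-elimˡ c) a) (closeL-agree ls (∧-elimʳ c) a)
    close-agree {bs} (μ y s) c a = cong (μ y) (close-agree s c (AgreeOn-[≔] {bs} y refl a))
    close-agree (var y)      c a = a y c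

    closeL-agree : ∀ {bs ε ε′} ls → ClosedL bs ls → AgreeOn bs ε ε′ → closeL ε ls ≡ closeL ε′ ls
    closeL-agree []             c a = refl
    closeL-agree ((l , s) ∷ ls) c a =
      cong₂ (λ x y → (l , x) ∷ y) (close-agree s (∧-elimˡ c) a) (closeL-agree ls (∧-elimʳ c) a)

  close-closed : ∀ {ε} u → Closed [] u → close ε u ≡ u
  close-closed u c = trans (close-agree u c (λ y ())) (close-var u)

  mutual
    Closed-close : ∀ {bs bs′ ε} t → Closed bs t → (∀ y → y ∈ᵇ bs → Closed bs′ (ε y)) → Closed bs′ (close ε t)
    Closed-close 𝟏            c h = refl
    Closed-close (?b t · s)   c h = Closed-close s c h
    Closed-close (!b t · s)   c h = Closed-close s c h
    Closed-close (?h p · s)   c h = ∧-intro (Closed-close p (∧-elimˡ c) h) (Closed-close s (∧-elimʳ c) h)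
    Closed-close (!h p · s)   c h = ∧-intro (Closed-close p (∧-elimˡ c) h) (Closed-close s (∧-elimʳ c) h)
    Closed-close (ext l s ls) c h = ∧-intro (Closed-close s (∧-elimˡ c) h) (ClosedL-close ls (∧-elimʳ c) h)
    Closed-close (int l s ls) c h = ∧-intro (Closed-close s (∧-elimˡ c) h) (ClosedL-close ls (∧-elimʳ c) h)
    Closed-close {bs} {bs′} {ε} (μ y s) c h = Closed-close s c h′
      where
      h′ : ∀ z → z ∈ᵇ (y ∷ bs) → Closed (y ∷ bs′) ((ε [ y ≔ var y ]) z)
      h′ z z∈ with z ≡ᵇ y | ≡ᵇ-reflects z y
      ... | true  | ofʸ refl = ∈ᵇ-here z bs′
      ... | false | _        = Closed-weaken-∷ y (ε z) (h z z∈)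
    Closed-close (var y)      c h = h y c

    ClosedL-close : ∀ {bs bs′ ε} ls → ClosedL bs ls → (∀ y → y ∈ᵇ bs → Closed bs′ (ε y)) →
                    ClosedL bs′ (closeL ε ls)
    ClosedL-close []             c h = refl
    ClosedL-close ((l , s) ∷ ls) c h = ∧-intro (Closed-close s (∧-elimˡ c) h) (ClosedL-close ls (∧-elimʳ c) h)

  ClosedOrVar : Env → Set
  ClosedOrVar ε = ∀ y → ε y ≡ var y ⊎ Closed [] (ε y)

  ClosedOrVar-[≔var] : ∀ {ε} y → ClosedOrVar ε → ClosedOrVar (ε [ y ≔ var y ])
  ClosedOrVar-[≔var] y h z with z ≡ᵇ y | ≡ᵇ-reflects z y
  ... | true  | ofʸ refl = inj₁ refl
  ... | false | _        = h z

  _⊙_ : Env → Env → Env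
  (η ⊙ ε) y = close η (ε y)

  mutual
    close-⊙ : ∀ {η ε} t → ClosedOrVar ε → close η (close ε t) ≡ close (η ⊙ ε) t
    close-⊙ 𝟏            h = refl
    close-⊙ (?b t · s)   h = cong (?b t ·_) (close-⊙ s h)
    close-⊙ (!b t · s)   h = cong (!b t ·_) (close-⊙ s h)
    close-⊙ (?h p · s)   h = cong₂ ?h_·_ (close-⊙ p h) (close-⊙ s h)
    close-⊙ (!h p · s)   h = cong₂ !h_·_ (close-⊙ p h) (close-⊙ s h)
    close-⊙ (ext l s ls) h = cong₂ (ext l) (close-⊙ s h) (closeL-⊙ ls h)
    close-⊙ (int l s ls) h = cong₂ (int l) (close-⊙ s h) (closeL-⊙ ls h)
    close-⊙ {η} {ε} (μ y s) h =
      cong (μ y) (trans (close-⊙ s (ClosedOrVar-[≔var] y h)) (close-cong s ⊙-[≔var]))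
      where
      ⊙-[≔var] : (η [ y ≔ var y ]) ⊙ (ε [ y ≔ var y ]) ≗ (η ⊙ ε) [ y ≔ var y ]
      ⊙-[≔var] z with z ≡ᵇ y | ≡ᵇ-reflects z y
      ... | true  | ofʸ refl rewrite ≡ᵇ-refl z = refl
      ... | false | ofⁿ z≢y with h z
      ...   | inj₁ εz≡z rewrite εz≡z | ≢⇒≡ᵇ-false z≢y = refl
      ...   | inj₂ c = trans (close-closed (ε z) c) (sym (close-closed (ε z) c))
    close-⊙ (var y)      h = refl

    closeL-⊙ : ∀ {η ε} ls → ClosedOrVar ε → closeL η (closeL ε ls) ≡ closeL (η ⊙ ε) ls
    closeL-⊙ []             h = refl
    closeL-⊙ ((l , s) ∷ ls) h = cong₂ (λ a b → (l , a) ∷ b) (close-⊙ s h) (closeL-⊙ ls h)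

  mutual
    subst≡close : ∀ s x u → subst s x u ≡ close (var [ x ≔ u ]) s
    subst≡close 𝟏            x u = refl
    subst≡close (?b t · s)   x u = cong (?b t ·_) (subst≡close s x u)
    subst≡close (!b t · s)   x u = cong (!b t ·_) (subst≡close s x u)
    subst≡close (?h p · s)   x u = cong₂ ?h_·_ (subst≡close p x u) (subst≡close s x u)
    subst≡close (!h p · s)   x u = cong₂ !h_·_ (subst≡close p x u) (subst≡close s x u)
    subst≡close (ext l s ls) x u = cong₂ (ext l) (subst≡close s x u) (substL≡closeL ls x u)
    subst≡close (int l s ls) x u = cong₂ (int l) (subst≡close s x u) (substL≡closeL ls x u)
    subst≡close (μ y s)      x u with x ≡ᵇ y | ≡ᵇ-reflects x y
    ... | true  | ofʸ refl = cong (μ x) (sym (trans (close-cong s shadowed) (close-var s)))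
      where
      shadowed : (var [ x ≔ u ]) [ x ≔ var x ] ≗ var
      shadowed z with z ≡ᵇ x | ≡ᵇ-reflects z x
      ... | true  | ofʸ refl = refl
      ... | false | _        = refl
    ... | false | ofⁿ x≢y = cong (μ y) (trans (subst≡close s x u) (close-cong s commute))
      where
      commute : var [ x ≔ u ] ≗ (var [ x ≔ u ]) [ y ≔ var y ]
      commute z with z ≡ᵇ y | ≡ᵇ-reflects z y
      ... | true  | ofʸ refl rewrite ≢⇒≡ᵇ-false (λ z≡x → x≢y (sym z≡x)) = refl
      ... | false | _        = refl
    subst≡close (var y)      x u with x ≡ᵇ y | ≡ᵇ-reflects x y
    ... | true  | ofʸ refl rewrite ≡ᵇ-refl x = refl
    ... | false | ofⁿ x≢y rewrite ≢⇒≡ᵇ-false (λ y≡x → x≢y (sym y≡x)) = refl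

    substL≡closeL : ∀ ls x u → substL ls x u ≡ closeL (var [ x ≔ u ]) ls
    substL≡closeL []             x u = refl
    substL≡closeL ((l , s) ∷ ls) x u = cong₂ (λ a b → (l , a) ∷ b) (subst≡close s x u) (substL≡closeL ls x u)

  Unguarded : Var → Term → Set
  Unguarded y t = unguardedOcc y t ≡ true

  Unguarded⇒∈ᵇ : ∀ {y bs} u → Unguarded y u → Closed bs u → y ∈ᵇ bs
  Unguarded⇒∈ᵇ {y} (var z) ug c with y ≡ᵇ z | ≡ᵇ-reflects y z
  ... | true | ofʸ refl = c
  Unguarded⇒∈ᵇ {y} {bs} (μ w s) ug c with y ≡ᵇ w | ≡ᵇ-reflects y w
  ... | false | ofⁿ y≢w with ∈ᵇ-∷⁻ {y} {w} {bs} (Unguarded⇒∈ᵇ {y} {w ∷ bs} s ug c)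
  ...   | inj₁ y≡w = ⊥-elim (y≢w y≡w)
  ...   | inj₂ y∈  = y∈

  ClosedOrVarOn : List Var → Env → Set
  ClosedOrVarOn bs ε = ∀ z → z ∈ᵇ bs → ε z ≡ var z ⊎ Closed [] (ε z)

  Unguarded-close⁻ : ∀ {bs ε y} s → Closed bs s → ClosedOrVarOn bs ε → ε y ≡ var y →
                     Unguarded y (close ε s) → Unguarded y s
  Unguarded-close⁻ {bs} {ε} {y} (var z) c h εy ug with h z c
  ... | inj₁ εz≡z rewrite εz≡z = ug
  ... | inj₂ cz with Unguarded⇒∈ᵇ {y} {[]} (ε z) ug cz
  ...   | ()
  Unguarded-close⁻ {bs} {ε} {y} (μ w s) c h εy ug with y ≡ᵇ w | ≡ᵇ-reflects y w
  ... | false | ofⁿ y≢w = Unguarded-close⁻ {w ∷ bs} {ε [ w ≔ var w ]} {y} s c h′ εy′ ug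
    where
    h′ : ClosedOrVarOn (w ∷ bs) (ε [ w ≔ var w ])
    h′ z z∈ with z ≡ᵇ w | ≡ᵇ-reflects z w
    ... | true  | ofʸ refl = inj₁ refl
    ... | false | _        = h z z∈
    εy′ : (ε [ w ≔ var w ]) y ≡ var y
    εy′ rewrite ≢⇒≡ᵇ-false y≢w = εy

  labels-closeL : ∀ ε ls → map proj₁ (closeL ε ls) ≡ map proj₁ ls
  labels-closeL ε []             = refl
  labels-closeL ε ((l , s) ∷ ls) = cong (l ∷_) (labels-closeL ε ls)

  WF : Term → Set
  WF t = wf t ≡ true

  WFL : List (Label × Term) → Set
  WFL ls = wfL ls ≡ true

  SCOrVarOn : List Var → Env → Set
  SCOrVarOn bs ε = ∀ z → z ∈ᵇ bs → ε z ≡ var z ⊎ (Closed [] (ε z) × WF (ε z))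

  SCOrVarOn⇒ClosedOrVarOn : ∀ {bs ε} → SCOrVarOn bs ε → ClosedOrVarOn bs ε
  SCOrVarOn⇒ClosedOrVarOn h z z∈ with h z z∈
  ... | inj₁ εz≡z     = inj₁ εz≡z
  ... | inj₂ (c , _) = inj₂ c

  SCOrVarOn-[≔var] : ∀ {bs ε} y → SCOrVarOn bs ε → SCOrVarOn (y ∷ bs) (ε [ y ≔ var y ])
  SCOrVarOn-[≔var] y h z z∈ with z ≡ᵇ y | ≡ᵇ-reflects z y
  ... | true  | ofʸ refl = inj₁ refl
  ... | false | _        = h z z∈

  [≔var]-self : ∀ ε y → (ε [ y ≔ var y ]) y ≡ var y
  [≔var]-self ε y rewrite ≡ᵇ-refl y = refl

  mutual
    WF-close : ∀ {bs ε} t → Closed bs t → WF t → SCOrVarOn bs ε → WF (close ε t)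
    WF-close 𝟏            c w h = refl
    WF-close (?b t · s)   c w h = WF-close s c w h
    WF-close (!b t · s)   c w h = WF-close s c w h
    WF-close (?h p · s)   c w h = ∧-intro (WF-close p (∧-elimˡ c) (∧-elimˡ w) h) (WF-close s (∧-elimʳ c) (∧-elimʳ w) h)
    WF-close (!h p · s)   c w h = ∧-intro (WF-close p (∧-elimˡ c) (∧-elimˡ w) h) (WF-close s (∧-elimʳ c) (∧-elimʳ w) h)
    WF-close {ε = ε} (ext l s ls) c w h rewrite labels-closeL ε ls =
      ∧-map-∧ (distinct (labels l ls)) (λ ws → WF-close s (∧-elimˡ c) ws h) (λ wls → WFL-close ls (∧-elimʳ c) wls h) w
    WF-close {ε = ε} (int l s ls) c w h rewrite labels-closeL ε ls =
      ∧-map-∧ (distinct (labels l ls)) (λ ws → WF-close s (∧-elimˡ c) ws h) (λ wls → WFL-close ls (∧-elimʳ c) wls h) w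
    WF-close {bs} {ε} (μ y s) c w h = ∧-intro still-guarded (WF-close s c (∧-elimʳ {not (unguardedOcc y s)} w) h′)
      where
      h′ : SCOrVarOn (y ∷ bs) (ε [ y ≔ var y ])
      h′ = SCOrVarOn-[≔var] {bs} y h
      still-guarded : not (unguardedOcc y (close (ε [ y ≔ var y ]) s)) ≡ true
      still-guarded = not-intro (not-true (∧-elimˡ w) ∘
        Unguarded-close⁻ {y ∷ bs} s c (SCOrVarOn⇒ClosedOrVarOn {y ∷ bs} h′) ([≔var]-self ε y))
    WF-close (var y) c w h with h y c
    ... | inj₁ εy≡y rewrite εy≡y = refl
    ... | inj₂ (_ , w′)         = w′

    WFL-close : ∀ {bs ε} ls → ClosedL bs ls → WFL ls → SCOrVarOn bs ε → WFL (closeL ε ls)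
    WFL-close []             c w h = refl
    WFL-close ((l , s) ∷ ls) c w h = ∧-intro (WF-close s (∧-elimˡ c) (∧-elimˡ w) h) (WFL-close ls (∧-elimʳ c) (∧-elimʳ w) h)

  μ-depth : Term → ℕ
  μ-depth (μ x s) = suc (μ-depth s)
  μ-depth _       = 0

  μ-depth-subst : ∀ s x u → unguardedOcc x s ≡ false → μ-depth (subst s x u) ≡ μ-depth s
  μ-depth-subst 𝟏            x u g = refl
  μ-depth-subst (?b t · s)   x u g = refl
  μ-depth-subst (!b t · s)   x u g = refl
  μ-depth-subst (?h p · s)   x u g = refl
  μ-depth-subst (!h p · s)   x u g = refl
  μ-depth-subst (ext l s ls) x u g = refl
  μ-depth-subst (int l s ls) x u g = refl
  μ-depth-subst (μ y s)      x u g with x ≡ᵇ y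
  ... | true  = refl
  ... | false = cong suc (μ-depth-subst s x u g)
  μ-depth-subst (var y)      x u g with x ≡ᵇ y
  μ-depth-subst (var y) x u () | true
  ... | false = refl

  IsSC : Term → Set
  IsSC t = T (isSC t)

  IsSC-intro : ∀ t → Closed [] t → WF t → IsSC t
  IsSC-intro t c w = Equivalence.from (T-≡ {isSC t}) (∧-intro c w)

  IsSC⇒Closed : ∀ t → IsSC t → Closed [] t
  IsSC⇒Closed t p = ∧-elimˡ {closedIn [] t} (Equivalence.to (T-≡ {isSC t}) p)

  IsSC⇒WF : ∀ t → IsSC t → WF t
  IsSC⇒WF t p = ∧-elimʳ {closedIn [] t} (Equivalence.to (T-≡ {isSC t}) p)

  unfold : Var → Term → Term
  unfold x s = subst s x (μ x s)

  IsSC-unfold : ∀ {x s} → IsSC (μ x s) → IsSC (unfold x s)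
  IsSC-unfold {x} {s} p rewrite subst≡close s x (μ x s) =
    IsSC-intro (close (var [ x ≔ μ x s ]) s) (Closed-close {x ∷ []} s c closed)
      (WF-close {x ∷ []} s c (∧-elimʳ {not (unguardedOcc x s)} w) sc)
    where
    c : Closed (x ∷ []) s
    c = IsSC⇒Closed (μ x s) p
    w : WF (μ x s)
    w = IsSC⇒WF (μ x s) p
    closed : ∀ y → y ∈ᵇ (x ∷ []) → Closed [] ((var [ x ≔ μ x s ]) y)
    closed y y∈ with y ≡ᵇ x
    ... | true = c
    closed y () | false
    sc : SCOrVarOn (x ∷ []) (var [ x ≔ μ x s ])
    sc y y∈ with y ≡ᵇ x
    ... | true = inj₂ (c , w)
    sc y () | false

  μ-depth-unfold : ∀ {x s} → IsSC (μ x s) → μ-depth (unfold x s) ≡ μ-depth s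
  μ-depth-unfold {x} {s} p =
    μ-depth-subst s x (μ x s) (not-true⇒false (∧-elimˡ {not (unguardedOcc x s)} (IsSC⇒WF (μ x s) p)))

  -- Payloads
  -- ?(σ′)/!(σ′) must stay literally equal, but σ′ may mention variables
  -- bound further out; the environment closes them with the recursion they
  -- stand for, so that the dual of an unfolding is an unfolding of the dual.
  mutual
    dualᴱ : Env → Term → Term
    dualᴱ η 𝟏            = 𝟏
    dualᴱ η (?b t · s)   = !b t · dualᴱ η s
    dualᴱ η (!b t · s)   = ?b t · dualᴱ η s
    dualᴱ η (?h p · s)   = !h close η p · dualᴱ η s
    dualᴱ η (!h p · s)   = ?h close η p · dualᴱ η s
    dualᴱ η (ext l s ls) = int l (dualᴱ η s) (dualᴱL η ls)
    dualᴱ η (int l s ls) = ext l (dualᴱ η s) (dualᴱL η ls)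
    dualᴱ η (μ y s)      = μ y (dualᴱ (η [ y ≔ close η (μ y s) ]) s)
    dualᴱ η (var y)      = var y

    dualᴱL : Env → List (Label × Term) → List (Label × Term)
    dualᴱL η []             = []
    dualᴱL η ((l , s) ∷ ls) = (l , dualᴱ η s) ∷ dualᴱL η ls

  dual : Term → Term
  dual = dualᴱ var

  mutual
    dualᴱ-cong : ∀ {η η′} t → η ≗ η′ → dualᴱ η t ≡ dualᴱ η′ t
    dualᴱ-cong 𝟏            e = refl
    dualᴱ-cong (?b t · s)   e = cong (!b t ·_) (dualᴱ-cong s e)
    dualᴱ-cong (!b t · s)   e = cong (?b t ·_) (dualᴱ-cong s e)
    dualᴱ-cong (?h p · s)   e = cong₂ !h_·_ (close-cong p e) (dualᴱ-cong s e)
    dualᴱ-cong (!h p · s)   e = cong₂ ?h_·_ (close-cong p e) (dualᴱ-cong s e)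
    dualᴱ-cong (ext l s ls) e = cong₂ (int l) (dualᴱ-cong s e) (dualᴱL-cong ls e)
    dualᴱ-cong (int l s ls) e = cong₂ (ext l) (dualᴱ-cong s e) (dualᴱL-cong ls e)
    dualᴱ-cong (μ y s)      e = cong (μ y) (dualᴱ-cong s ([≔]-cong y e (close-cong (μ y s) e)))
    dualᴱ-cong (var y)      e = refl

    dualᴱL-cong : ∀ {η η′} ls → η ≗ η′ → dualᴱL η ls ≡ dualᴱL η′ ls
    dualᴱL-cong []             e = refl
    dualᴱL-cong ((l , s) ∷ ls) e = cong₂ (λ a b → (l , a) ∷ b) (dualᴱ-cong s e) (dualᴱL-cong ls e)

  mutual
    dualᴱ-agree : ∀ {bs η η′} t → Closed bs t → AgreeOn bs η η′ → dualᴱ η t ≡ dualᴱ η′ t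
    dualᴱ-agree 𝟏            c a = refl
    dualᴱ-agree (?b t · s)   c a = cong (!b t ·_) (dualᴱ-agree s c a)
    dualᴱ-agree (!b t · s)   c a = cong (?b t ·_) (dualᴱ-agree s c a)
    dualᴱ-agree (?h p · s)   c a = cong₂ !h_·_ (close-agree p (∧-elimˡ c) a) (dualᴱ-agree s (∧-elimʳ c) a)
    dualᴱ-agree (!h p · s)   c a = cong₂ ?h_·_ (close-agree p (∧-elimˡ c) a) (dualᴱ-agree s (∧-elimʳ c) a)
    dualᴱ-agree (ext l s ls) c a = cong₂ (int l) (dualᴱ-agree s (∧-elimˡ c) a) (dualᴱL-agree ls (∧-elimʳ c) a)
    dualᴱ-agree (int l s ls) c a = cong₂ (ext l) (dualᴱ-agree s (∧-elimˡ c) a) (dualᴱL-agree ls (∧-elimʳ c) a)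
    dualᴱ-agree {bs} (μ y s) c a =
      cong (μ y) (dualᴱ-agree s c (AgreeOn-[≔] {bs} y (close-agree (μ y s) c a) a))
    dualᴱ-agree (var y)      c a = refl

    dualᴱL-agree : ∀ {bs η η′} ls → ClosedL bs ls → AgreeOn bs η η′ → dualᴱL η ls ≡ dualᴱL η′ ls
    dualᴱL-agree []             c a = refl
    dualᴱL-agree ((l , s) ∷ ls) c a =
      cong₂ (λ x y → (l , x) ∷ y) (dualᴱ-agree s (∧-elimˡ c) a) (dualᴱL-agree ls (∧-elimʳ c) a)

  dualᴱ-closed : ∀ {η η′} t → Closed [] t → dualᴱ η t ≡ dualᴱ η′ t
  dualᴱ-closed t c = dualᴱ-agree t c (λ y ())

  close-payload : ∀ {bs η ε} p → Closed bs p → ClosedOrVar ε →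
                  (∀ y → y ∈ᵇ bs → Closed [] (close η (ε y))) →
                  close η (close ε p) ≡ close (dualᴱ η ∘ ε) (close (η ⊙ ε) p)
  close-payload {bs} {η} {ε} p c hε h =
    trans (close-⊙ p hε) (sym (close-closed (close (η ⊙ ε) p) (Closed-close p c h)))

  mutual
    dualᴱ-close : ∀ {bs η ε} s → Closed bs s → ClosedOrVar ε →
                  (∀ y → y ∈ᵇ bs → Closed [] (close η (ε y))) →
                  dualᴱ η (close ε s) ≡ close (dualᴱ η ∘ ε) (dualᴱ (η ⊙ ε) s)
    dualᴱ-close 𝟏            c hε h = refl
    dualᴱ-close (?b t · s)   c hε h = cong (!b t ·_) (dualᴱ-close s c hε h)
    dualᴱ-close (!b t · s)   c hε h = cong (?b t ·_) (dualᴱ-close s c hε h)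
    dualᴱ-close (?h p · s)   c hε h =
      cong₂ !h_·_ (close-payload p (∧-elimˡ c) hε h) (dualᴱ-close s (∧-elimʳ c) hε h)
    dualᴱ-close (!h p · s)   c hε h =
      cong₂ ?h_·_ (close-payload p (∧-elimˡ c) hε h) (dualᴱ-close s (∧-elimʳ c) hε h)
    dualᴱ-close (ext l s ls) c hε h =
      cong₂ (int l) (dualᴱ-close s (∧-elimˡ c) hε h) (dualᴱL-close ls (∧-elimʳ c) hε h)
    dualᴱ-close (int l s ls) c hε h =
      cong₂ (ext l) (dualᴱ-close s (∧-elimˡ c) hε h) (dualᴱL-close ls (∧-elimʳ c) hε h)
    dualᴱ-close {bs} {η} {ε} (μ z s) c hε h =
      cong (μ z) (begin
        dualᴱ η′ (close ε′ s)
          ≡⟨ dualᴱ-close {z ∷ bs} {η′} {ε′} s c (ClosedOrVar-[≔var] z hε) h′ ⟩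
        close (dualᴱ η′ ∘ ε′) (dualᴱ (η′ ⊙ ε′) s)
          ≡⟨ close-cong (dualᴱ (η′ ⊙ ε′) s) dual-ε′ ⟩
        close ((dualᴱ η ∘ ε) [ z ≔ var z ]) (dualᴱ (η′ ⊙ ε′) s)
          ≡⟨ cong (close ((dualᴱ η ∘ ε) [ z ≔ var z ])) (dualᴱ-cong s η′⊙ε′) ⟩
        close ((dualᴱ η ∘ ε) [ z ≔ var z ]) (dualᴱ ((η ⊙ ε) [ z ≔ close (η ⊙ ε) (μ z s) ]) s) ∎)
      where
      open ≡-Reasoning
      ε′ : Env
      ε′ = ε [ z ≔ var z ]
      V : Term
      V = close η (μ z (close ε′ s))
      η′ : Env
      η′ = η [ z ≔ V ]
      V≡ : V ≡ close (η ⊙ ε) (μ z s)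
      V≡ = close-⊙ (μ z s) hε
      V-closed : Closed [] V
      V-closed = transport (Closed []) (sym V≡) (Closed-close {bs} {[]} {η ⊙ ε} (μ z s) c h)
      h′ : ∀ y → y ∈ᵇ (z ∷ bs) → Closed [] (close η′ (ε′ y))
      h′ y y∈ with y ≡ᵇ z | ≡ᵇ-reflects y z
      ... | true  | ofʸ refl rewrite ≡ᵇ-refl y = V-closed
      ... | false | ofⁿ y≢z with hε y
      ...   | inj₁ εy≡y rewrite εy≡y | ≢⇒≡ᵇ-false y≢z = transport (λ q → Closed [] (close η q)) εy≡y (h y y∈)
      ...   | inj₂ cy rewrite close-closed {η′} (ε y) cy = cy
      dual-ε′ : dualᴱ η′ ∘ ε′ ≗ (dualᴱ η ∘ ε) [ z ≔ var z ]
      dual-ε′ y with y ≡ᵇ z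
      ... | true  = refl
      ... | false with hε y
      ...   | inj₁ εy≡y rewrite εy≡y = refl
      ...   | inj₂ cy = dualᴱ-closed (ε y) cy
      η′⊙ε′ : η′ ⊙ ε′ ≗ (η ⊙ ε) [ z ≔ close (η ⊙ ε) (μ z s) ]
      η′⊙ε′ y with y ≡ᵇ z | ≡ᵇ-reflects y z
      ... | true  | ofʸ refl rewrite ≡ᵇ-refl y = V≡
      ... | false | ofⁿ y≢z with hε y
      ...   | inj₁ εy≡y rewrite εy≡y | ≢⇒≡ᵇ-false y≢z = refl
      ...   | inj₂ cy = trans (close-closed (ε y) cy) (sym (close-closed (ε y) cy))
    dualᴱ-close (var y)      c hε h = refl

    dualᴱL-close : ∀ {bs η ε} ls → ClosedL bs ls → ClosedOrVar ε →
                   (∀ y → y ∈ᵇ bs → Closed [] (close η (ε y))) →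
                   dualᴱL η (closeL ε ls) ≡ closeL (dualᴱ η ∘ ε) (dualᴱL (η ⊙ ε) ls)
    dualᴱL-close []             c hε h = refl
    dualᴱL-close ((l , s) ∷ ls) c hε h =
      cong₂ (λ a b → (l , a) ∷ b) (dualᴱ-close s (∧-elimˡ c) hε h) (dualᴱL-close ls (∧-elimʳ c) hε h)


  dual-unfold : ∀ x s → IsSC (μ x s) →
                unfold x (dualᴱ (var [ x ≔ close var (μ x s) ]) s) ≡ dual (unfold x s)
  dual-unfold x s p = sym (begin
      dual (subst s x b)                                  ≡⟨ cong dual (subst≡close s x b) ⟩
      dual (close ε s)                                    ≡⟨ dualᴱ-close {x ∷ []} s c ε-closedOrVar closed ⟩
      close (dual ∘ ε) (dualᴱ (var ⊙ ε) s)                ≡⟨ close-cong (dualᴱ (var ⊙ ε) s) dual-ε ⟩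
      close (var [ x ≔ dual b ]) (dualᴱ (var ⊙ ε) s)      ≡⟨ cong (close (var [ x ≔ dual b ])) (dualᴱ-cong s var⊙ε) ⟩
      close (var [ x ≔ dual b ]) (dualᴱ ε′ s)             ≡⟨ sym (subst≡close (dualᴱ ε′ s) x (dual b)) ⟩
      subst (dualᴱ ε′ s) x (dual b)                        ∎)
    where
    open ≡-Reasoning
    b : Term
    b = μ x s
    ε ε′ : Env
    ε  = var [ x ≔ b ]
    ε′ = var [ x ≔ close var b ]
    c : Closed [] b
    c = IsSC⇒Closed b p
    ε-closedOrVar : ClosedOrVar ε
    ε-closedOrVar y with y ≡ᵇ x
    ... | true  = inj₂ c
    ... | false = inj₁ refl
    closed : ∀ y → y ∈ᵇ (x ∷ []) → Closed [] (close var (ε y))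
    closed y y∈ with y ≡ᵇ x
    ... | true = transport (Closed []) (sym (close-var b)) c
    closed y () | false
    dual-ε : dual ∘ ε ≗ var [ x ≔ dual b ]
    dual-ε y with y ≡ᵇ x
    ... | true  = refl
    ... | false = refl
    var⊙ε : var ⊙ ε ≗ ε′
    var⊙ε y with y ≡ᵇ x
    ... | true  = refl
    ... | false = refl

  unguardedOcc-dualᴱ : ∀ y η t → unguardedOcc y (dualᴱ η t) ≡ unguardedOcc y t
  unguardedOcc-dualᴱ y η 𝟏            = refl
  unguardedOcc-dualᴱ y η (?b t · s)   = refl
  unguardedOcc-dualᴱ y η (!b t · s)   = refl
  unguardedOcc-dualᴱ y η (?h p · s)   = refl
  unguardedOcc-dualᴱ y η (!h p · s)   = refl
  unguardedOcc-dualᴱ y η (ext l s ls) = refl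
  unguardedOcc-dualᴱ y η (int l s ls) = refl
  unguardedOcc-dualᴱ y η (μ w s) with y ≡ᵇ w
  ... | true  = refl
  ... | false = unguardedOcc-dualᴱ y _ s
  unguardedOcc-dualᴱ y η (var z)      = refl

  labels-dualᴱL : ∀ η ls → map proj₁ (dualᴱL η ls) ≡ map proj₁ ls
  labels-dualᴱL η []             = refl
  labels-dualᴱL η ((l , s) ∷ ls) = cong (l ∷_) (labels-dualᴱL η ls)

  mutual
    Closed-dualᴱ : ∀ {bs η} t → Closed bs t → (∀ y → y ∈ᵇ bs → Closed bs (η y)) → Closed bs (dualᴱ η t)
    Closed-dualᴱ 𝟏            c h = refl
    Closed-dualᴱ (?b t · s)   c h = Closed-dualᴱ s c h
    Closed-dualᴱ (!b t · s)   c h = Closed-dualᴱ s c h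
    Closed-dualᴱ (?h p · s)   c h = ∧-intro (Closed-close p (∧-elimˡ c) h) (Closed-dualᴱ s (∧-elimʳ c) h)
    Closed-dualᴱ (!h p · s)   c h = ∧-intro (Closed-close p (∧-elimˡ c) h) (Closed-dualᴱ s (∧-elimʳ c) h)
    Closed-dualᴱ (ext l s ls) c h = ∧-intro (Closed-dualᴱ s (∧-elimˡ c) h) (ClosedL-dualᴱL ls (∧-elimʳ c) h)
    Closed-dualᴱ (int l s ls) c h = ∧-intro (Closed-dualᴱ s (∧-elimˡ c) h) (ClosedL-dualᴱL ls (∧-elimʳ c) h)
    Closed-dualᴱ {bs} {η} (μ y s) c h = Closed-dualᴱ s c h′
      where
      h′ : ∀ z → z ∈ᵇ (y ∷ bs) → Closed (y ∷ bs) ((η [ y ≔ close η (μ y s) ]) z)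
      h′ z z∈ with z ≡ᵇ y
      ... | true  = Closed-weaken-∷ y (close η (μ y s)) (Closed-close {bs} (μ y s) c h)
      ... | false = Closed-weaken-∷ y (η z) (h z z∈)
    Closed-dualᴱ (var y)      c h = c

    ClosedL-dualᴱL : ∀ {bs η} ls → ClosedL bs ls → (∀ y → y ∈ᵇ bs → Closed bs (η y)) → ClosedL bs (dualᴱL η ls)
    ClosedL-dualᴱL []             c h = refl
    ClosedL-dualᴱL ((l , s) ∷ ls) c h = ∧-intro (Closed-dualᴱ s (∧-elimˡ c) h) (ClosedL-dualᴱL ls (∧-elimʳ c) h)

  SCOn : List Var → Env → Set
  SCOn bs η = ∀ y → y ∈ᵇ bs → Closed [] (η y) × WF (η y)

  mutual
    WF-dualᴱ : ∀ {bs η} t → Closed bs t → WF t → SCOn bs η → WF (dualᴱ η t)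
    WF-dualᴱ 𝟏            c w h = refl
    WF-dualᴱ (?b t · s)   c w h = WF-dualᴱ s c w h
    WF-dualᴱ (!b t · s)   c w h = WF-dualᴱ s c w h
    WF-dualᴱ (?h p · s)   c w h =
      ∧-intro (WF-close p (∧-elimˡ c) (∧-elimˡ w) (λ z z∈ → inj₂ (h z z∈))) (WF-dualᴱ s (∧-elimʳ c) (∧-elimʳ w) h)
    WF-dualᴱ (!h p · s)   c w h =
      ∧-intro (WF-close p (∧-elimˡ c) (∧-elimˡ w) (λ z z∈ → inj₂ (h z z∈))) (WF-dualᴱ s (∧-elimʳ c) (∧-elimʳ w) h)
    WF-dualᴱ {η = η} (ext l s ls) c w h rewrite labels-dualᴱL η ls =
      ∧-map-∧ (distinct (labels l ls)) (λ ws → WF-dualᴱ s (∧-elimˡ c) ws h) (λ wls → WFL-dualᴱL ls (∧-elimʳ c) wls h) w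
    WF-dualᴱ {η = η} (int l s ls) c w h rewrite labels-dualᴱL η ls =
      ∧-map-∧ (distinct (labels l ls)) (λ ws → WF-dualᴱ s (∧-elimˡ c) ws h) (λ wls → WFL-dualᴱL ls (∧-elimʳ c) wls h) w
    WF-dualᴱ {bs} {η} (μ y s) c w h rewrite unguardedOcc-dualᴱ y (η [ y ≔ close η (μ y s) ]) s =
      ∧-intro (∧-elimˡ w) (WF-dualᴱ s c (∧-elimʳ {not (unguardedOcc y s)} w) h′)
      where
      h′ : SCOn (y ∷ bs) (η [ y ≔ close η (μ y s) ])
      h′ z z∈ with z ≡ᵇ y
      ... | true  = Closed-close {bs} (μ y s) c (λ z z∈ → proj₁ (h z z∈))
                  , WF-close {bs} (μ y s) c w (λ z z∈ → inj₂ (h z z∈))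
      ... | false = h z z∈
    WF-dualᴱ (var y)      c w h = refl

    WFL-dualᴱL : ∀ {bs η} ls → ClosedL bs ls → WFL ls → SCOn bs η → WFL (dualᴱL η ls)
    WFL-dualᴱL []             c w h = refl
    WFL-dualᴱL ((l , s) ∷ ls) c w h =
      ∧-intro (WF-dualᴱ s (∧-elimˡ c) (∧-elimˡ w) h) (WFL-dualᴱL ls (∧-elimʳ c) (∧-elimʳ w) h)

  IsSC-dual : ∀ t → IsSC t → IsSC (dual t)
  IsSC-dual t p = IsSC-intro (dual t) (Closed-dualᴱ {[]} t (IsSC⇒Closed t p) (λ y ()))
                                      (WF-dualᴱ {[]} t (IsSC⇒Closed t p) (IsSC⇒WF t p) (λ y ()))

  Closed-∈ : ∀ {bs k c} ls → (k , c) ∈ ls → ClosedL bs ls → Closed bs c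
  Closed-∈ ((l , s) ∷ ls) (here refl) c = ∧-elimˡ c
  Closed-∈ ((l , s) ∷ ls) (there m)   c = Closed-∈ ls m (∧-elimʳ c)

  WF-∈ : ∀ {k c} ls → (k , c) ∈ ls → WFL ls → WF c
  WF-∈ ((l , s) ∷ ls) (here refl) w = ∧-elimˡ w
  WF-∈ ((l , s) ∷ ls) (there m)   w = WF-∈ ls m (∧-elimʳ w)

  ClosedL-∀ : ∀ {bs} ls → (∀ {k c} → (k , c) ∈ ls → Closed bs c) → ClosedL bs ls
  ClosedL-∀ []             h = refl
  ClosedL-∀ ((l , s) ∷ ls) h = ∧-intro (h (here refl)) (ClosedL-∀ ls (h ∘ there))

  WFL-∀ : ∀ ls → (∀ {k c} → (k , c) ∈ ls → WF c) → WFL ls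
  WFL-∀ []             h = refl
  WFL-∀ ((l , s) ∷ ls) h = ∧-intro (h (here refl)) (WFL-∀ ls (h ∘ there))

  ∈-dualᴱL⁺ : ∀ {η k c} ls → (k , c) ∈ ls → (k , dualᴱ η c) ∈ dualᴱL η ls
  ∈-dualᴱL⁺ ((l , s) ∷ ls) (here refl) = here refl
  ∈-dualᴱL⁺ ((l , s) ∷ ls) (there m)   = there (∈-dualᴱL⁺ ls m)

  ∈-dualᴱL⁻ : ∀ {η k d} ls → (k , d) ∈ dualᴱL η ls → Σ Term λ c → (k , c) ∈ ls × d ≡ dualᴱ η c
  ∈-dualᴱL⁻ ((l , s) ∷ ls) (here refl) = s , here refl , refl
  ∈-dualᴱL⁻ ((l , s) ∷ ls) (there m) with ∈-dualᴱL⁻ ls m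
  ... | c , m′ , d≡ = c , there m′ , d≡

  ∈⇒label-∈ᵇ : ∀ {k} {c : Term} ls → (k , c) ∈ ls → k ∈ᵇ map proj₁ ls
  ∈⇒label-∈ᵇ ((l , s) ∷ ls) (here refl) = ∨-introˡ (≡ᵇ-refl l)
  ∈⇒label-∈ᵇ {k} ((l , s) ∷ ls) (there m) = ∨-introʳ {k ≡ᵇ l} (∈⇒label-∈ᵇ ls m)

  distinct-∈-unique : ∀ {k} {c d : Term} ls → distinct (map proj₁ ls) ≡ true → (k , c) ∈ ls → (k , d) ∈ ls → c ≡ d
  distinct-∈-unique (_ ∷ ls) D (here refl) (here refl) = refl
  distinct-∈-unique (_ ∷ ls) D (here refl) (there m)   = ⊥-elim (not-true (∧-elimˡ D) (∈⇒label-∈ᵇ ls m))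
  distinct-∈-unique (_ ∷ ls) D (there m)   (here refl) = ⊥-elim (not-true (∧-elimˡ D) (∈⇒label-∈ᵇ ls m))
  distinct-∈-unique (_ ∷ ls) D (there m)   (there m′)  = distinct-∈-unique ls (∧-elimʳ D) m m′

  -- Stated for ext; int l s ls has literally the same closedness and
  -- well-formedness conditions.
  IsSC-branch : ∀ {l s ls k c} → Closed [] (ext l s ls) → WF (ext l s ls) → (k , c) ∈ ((l , s) ∷ ls) → IsSC c
  IsSC-branch {l} {s} {ls} {c = c} cl w m =
    IsSC-intro c (Closed-∈ ((l , s) ∷ ls) m cl) (WF-∈ ((l , s) ∷ ls) m (∧-elimʳ {distinct (labels l ls)} w))

  IsSC-ext-branch : ∀ {l s ls k c} → IsSC (ext l s ls) → (k , c) ∈ ((l , s) ∷ ls) → IsSC c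
  IsSC-ext-branch {l} {s} {ls} p = IsSC-branch (IsSC⇒Closed (ext l s ls) p) (IsSC⇒WF (ext l s ls) p)

  IsSC-int-branch : ∀ {l s ls k c} → IsSC (int l s ls) → (k , c) ∈ ((l , s) ∷ ls) → IsSC c
  IsSC-int-branch {l} {s} {ls} p = IsSC-branch (IsSC⇒Closed (int l s ls) p) (IsSC⇒WF (int l s ls) p)

  IsSC-int-chosen : ∀ {l s ls k c} → IsSC (int l s ls) → (k , c) ∈ ((l , s) ∷ ls) → IsSC (int k c [])
  IsSC-int-chosen {l} {s} {ls} {k} {c} p m = IsSC-intro (int k c [])
    (∧-intro (IsSC⇒Closed c pc) refl) (∧-intro refl (∧-intro (IsSC⇒WF c pc) refl))
    where
    pc : IsSC c
    pc = IsSC-int-branch {l} {s} {ls} p m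

  distinct-ext : ∀ {l s ls} → IsSC (ext l s ls) → distinct (labels l ls) ≡ true
  distinct-ext {l} {s} {ls} p = ∧-elimˡ (IsSC⇒WF (ext l s ls) p)

  distinct-int : ∀ {l s ls} → IsSC (int l s ls) → distinct (labels l ls) ≡ true
  distinct-int {l} {s} {ls} p = ∧-elimˡ (IsSC⇒WF (int l s ls) p)

  IsSC-payload-in : ∀ {q s} → IsSC (?h q · s) → IsSC q
  IsSC-payload-in {q} {s} p = IsSC-intro q (∧-elimˡ (IsSC⇒Closed (?h q · s) p)) (∧-elimˡ (IsSC⇒WF (?h q · s) p))

  IsSC-payload-out : ∀ {q s} → IsSC (!h q · s) → IsSC q
  IsSC-payload-out {q} {s} p = IsSC-intro q (∧-elimˡ (IsSC⇒Closed (!h q · s) p)) (∧-elimˡ (IsSC⇒WF (!h q · s) p))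

  IsSC-act : ∀ {s a c} → IsSC s → s —[ act a ]→ c → IsSC c
  IsSC-act p pre-?t = p
  IsSC-act p pre-!t = p
  IsSC-act {?h q · c} p (pre-?σ _) =
    IsSC-intro c (∧-elimʳ (IsSC⇒Closed (?h q · c) p)) (∧-elimʳ (IsSC⇒WF (?h q · c) p))
  IsSC-act { !h q · c } p (pre-!σ _) =
    IsSC-intro c (∧-elimʳ (IsSC⇒Closed (!h q · c) p)) (∧-elimʳ (IsSC⇒WF (!h q · c) p))
  IsSC-act {int l c []} p pre-!l = IsSC-int-branch {l} {c} {[]} p (here refl)
  IsSC-act {ext l s ls} p (ext-?l m) = IsSC-ext-branch {l} {s} {ls} p m

  IsSC-τ : ∀ {s s′} → IsSC s → s —[ τ ]→ s′ → IsSC s′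
  IsSC-τ {int l s ls} p (int-τ m) = IsSC-int-chosen {l} {s} {ls} p m
  IsSC-τ {μ x s}      p rec-τ     = IsSC-unfold {x} {s} p

  ok? : ∀ t → Dec (Ok t)
  ok? 𝟏            = yes ok-𝟏
  ok? (?b _ · _)   = no λ ()
  ok? (!b _ · _)   = no λ ()
  ok? (?h _ · _)   = no λ ()
  ok? (!h _ · _)   = no λ ()
  ok? (ext _ _ _)  = no λ ()
  ok? (int _ _ _)  = no λ ()
  ok? (μ _ _)      = no λ ()
  ok? (var _)      = no λ ()

module Transitions (BT : Set) (_≤:_ : BT → BT → Set) where
  open Contracts BT _≤:_
  open Syntax BT _≤:_

  co : Act → Act
  co (?l k) = !l k
  co (!l k) = ?l k
  co (?t t) = !t t
  co (!t t) = ?t t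
  co (?σ d) = !σ d
  co (!σ d) = ?σ d

  prefix : Act → Term → Term
  prefix (?l k) ρ = ext k ρ []
  prefix (!l k) ρ = int k ρ []
  prefix (?t t) ρ = ?b t · ρ
  prefix (!t t) ρ = !b t · ρ
  prefix (?σ d) ρ = ?h term d · ρ
  prefix (!σ d) ρ = !h term d · ρ

  prefix-step : ∀ a ρ → prefix a ρ —[ act a ]→ ρ
  prefix-step (?l k)       ρ = ext-?l (here refl)
  prefix-step (!l k)       ρ = pre-!l
  prefix-step (?t t)       ρ = pre-?t
  prefix-step (!t t)       ρ = pre-!t
  prefix-step (?σ (d , p)) ρ = pre-?σ p
  prefix-step (!σ (d , p)) ρ = pre-!σ p

  prefix-step⁻ : ∀ {a b ρ x} → prefix a ρ —[ act b ]→ x → b ≡ a × x ≡ ρ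
  prefix-step⁻ {?l k}       (ext-?l (here refl)) = refl , refl
  prefix-step⁻ { !l k }     pre-!l               = refl , refl
  prefix-step⁻ {?t t}       pre-?t               = refl , refl
  prefix-step⁻ { !t t }     pre-!t               = refl , refl
  prefix-step⁻ {?σ (d , p)} (pre-?σ q) rewrite T-irrelevant {isSC d} p q = refl , refl
  prefix-step⁻ { !σ (d , p) } (pre-!σ q) rewrite T-irrelevant {isSC d} p q = refl , refl

  prefix-¬τ : ∀ {a ρ x} → ¬ (prefix a ρ —[ τ ]→ x)
  prefix-¬τ {?l k} ()
  prefix-¬τ { !l k } ()
  prefix-¬τ {?t t} ()
  prefix-¬τ { !t t } ()
  prefix-¬τ {?σ d} ()
  prefix-¬τ { !σ d } ()

  prefix-¬Ok : ∀ {a ρ} → ¬ Ok (prefix a ρ)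
  prefix-¬Ok {?l k} ()
  prefix-¬Ok { !l k } ()
  prefix-¬Ok {?t t} ()
  prefix-¬Ok { !t t } ()
  prefix-¬Ok {?σ d} ()
  prefix-¬Ok { !σ d } ()

  IsSC-prefix : ∀ a ρ → IsSC ρ → IsSC (prefix a ρ)
  IsSC-prefix (?l k)       ρ p =
    IsSC-intro (ext k ρ []) (∧-intro (IsSC⇒Closed ρ p) refl) (∧-intro refl (∧-intro (IsSC⇒WF ρ p) refl))
  IsSC-prefix (!l k)       ρ p =
    IsSC-intro (int k ρ []) (∧-intro (IsSC⇒Closed ρ p) refl) (∧-intro refl (∧-intro (IsSC⇒WF ρ p) refl))
  IsSC-prefix (?t t)       ρ p = p
  IsSC-prefix (!t t)       ρ p = p
  IsSC-prefix (?σ (d , q)) ρ p =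
    IsSC-intro (?h d · ρ) (∧-intro (IsSC⇒Closed d q) (IsSC⇒Closed ρ p)) (∧-intro (IsSC⇒WF d q) (IsSC⇒WF ρ p))
  IsSC-prefix (!σ (d , q)) ρ p =
    IsSC-intro (!h d · ρ) (∧-intro (IsSC⇒Closed d q) (IsSC⇒Closed ρ p)) (∧-intro (IsSC⇒WF d q) (IsSC⇒WF ρ p))

  Stable : Term → Set
  Stable t = ∀ {y} → ¬ (t —[ τ ]→ y)

  act⇒¬τ : ∀ {t a x y} → t —[ act a ]→ x → ¬ (t —[ τ ]→ y)
  act⇒¬τ pre-?t      ()
  act⇒¬τ pre-!t      ()
  act⇒¬τ (pre-?σ _)  ()
  act⇒¬τ (pre-!σ _)  ()
  act⇒¬τ pre-!l      ()
  act⇒¬τ (ext-?l _)  ()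

  act⇒¬Ok : ∀ {t a x} → t —[ act a ]→ x → ¬ Ok t
  act⇒¬Ok () ok-𝟏

  IsExt : Term → Set
  IsExt (ext _ _ _) = ⊤
  IsExt _           = ⊥

  ?l⇒IsExt : ∀ {t k x} → t —[ act (?l k) ]→ x → IsExt t
  ?l⇒IsExt (ext-?l _) = tt

  IsExt-act⇒?l : ∀ {t a x} → IsExt t → t —[ act a ]→ x → Σ Label λ k → a ≡ ?l k
  IsExt-act⇒?l _ (ext-?l _) = _ , refl

  act-deterministic : ∀ {t a b x y} → t —[ act a ]→ x → t —[ act b ]→ y → (a ≡ b × x ≡ y) ⊎ IsExt t
  act-deterministic pre-?t pre-?t = inj₁ (refl , refl)
  act-deterministic pre-!t pre-!t = inj₁ (refl , refl)
  act-deterministic {?h d · _} (pre-?σ p) (pre-?σ q) rewrite T-irrelevant {isSC d} p q = inj₁ (refl , refl)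
  act-deterministic { !h d · _ } (pre-!σ p) (pre-!σ q) rewrite T-irrelevant {isSC d} p q = inj₁ (refl , refl)
  act-deterministic pre-!l pre-!l = inj₁ (refl , refl)
  act-deterministic (ext-?l _) _  = inj₂ tt

  act-functional : ∀ {t a x y} → IsSC t → t —[ act a ]→ x → t —[ act a ]→ y → x ≡ y
  act-functional p t₁ t₂ with act-deterministic t₁ t₂
  ... | inj₁ (_ , x≡y) = x≡y
  act-functional {ext l s ls} p (ext-?l m₁) (ext-?l m₂) | inj₂ _ =
    distinct-∈-unique ((l , s) ∷ ls) (distinct-ext {l} {s} {ls} p) m₁ m₂

  !l-determines : ∀ {t a x i y} → t —[ act a ]→ x → t —[ act (!l i) ]→ y → a ≡ !l i × x ≡ y
  !l-determines t₁ t₂ with act-deterministic t₁ t₂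
  ... | inj₁ eqs = eqs
  ... | inj₂ e with IsExt-act⇒?l e t₂
  ...   | _ , ()

  IsOutputOf : Act → List (Label × Term) → Set
  IsOutputOf a bs = Σ Label λ k → Σ Term λ c → a ≡ !l k × (k , c) ∈ bs

  isOutputOf? : ∀ a bs → Dec (IsOutputOf a bs)
  isOutputOf? (!l k) []             = no λ { (_ , _ , _ , ()) }
  isOutputOf? (!l k) ((i , d) ∷ bs) with k ≟ i | isOutputOf? (!l k) bs
  ... | yes refl | _ = yes (k , d , refl , here refl)
  ... | no _ | yes (k′ , c , eq , m) = yes (k′ , c , eq , there m)
  ... | no k≢i | no ¬o = no λ { (_ , _ , refl , here refl) → k≢i refl ; (k′ , c , eq , there m) → ¬o (k′ , c , eq , m) }
  isOutputOf? (?l _) _ = no λ { (_ , _ , () , _) }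
  isOutputOf? (?t _) _ = no λ { (_ , _ , () , _) }
  isOutputOf? (!t _) _ = no λ { (_ , _ , () , _) }
  isOutputOf? (?σ _) _ = no λ { (_ , _ , () , _) }
  isOutputOf? (!σ _) _ = no λ { (_ , _ , () , _) }

module Compliance (BT : Set) (_≤:_ : BT → BT → Set) (B : Rel (Contracts.SC BT _≤:_) 0ℓ) where
  open Contracts BT _≤:_
  open WithB B
  open Syntax BT _≤:_
  open Transitions BT _≤:_

  data Reach (a b : Term) : Term → Term → Set where
    done : Reach a b a b
    step : ∀ {a₁ b₁ a′ b′} → Step a b a₁ b₁ → Reach a₁ b₁ a′ b′ → Reach a b a′ b′

  -- ⊨ is a greatest fixed point; on terms it is the safety property that
  -- every reachable stuck configuration is successful.
  Compliant : Term → Term → Set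
  Compliant a b = ∀ {a′ b′} → Reach a b a′ b′ → Stuck a′ b′ → Ok a′ × Ok b′

  Compliant-stuck : ∀ {a b} → Compliant a b → Stuck a b → Ok a × Ok b
  Compliant-stuck c = c done

  Compliant-step : ∀ {a b a′ b′} → Compliant a b → Step a b a′ b′ → Compliant a′ b′
  Compliant-step c st r = c (step st r)

  Compliant-intro : ∀ {a b} → (Stuck a b → Ok a × Ok b) →
                    (∀ {a′ b′} → Step a b a′ b′ → Compliant a′ b′) → Compliant a b
  Compliant-intro h k done       = h
  Compliant-intro h k (step st r) = k st r

  Compliant-coinduction : (P : Term → Term → Set) → (∀ {a b} → P a b → Stuck a b → Ok a × Ok b) →
                          (∀ {a b a′ b′} → P a b → Step a b a′ b′ → P a′ b′) →
                          ∀ {a b} → P a b → Compliant a b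
  Compliant-coinduction P stuck step-P p done        = stuck p
  Compliant-coinduction P stuck step-P p (step st r) = Compliant-coinduction P stuck step-P (step-P p st) r

  Compliant-stable : ∀ {a b} → ¬ ¬ Compliant a b → Compliant a b
  Compliant-stable {a} {b} ¬¬c {a′} {b′} r st with ok? a′ | ok? b′
  ... | yes oa | yes ob = oa , ob
  ... | no ¬oa | _      = ⊥-elim (¬¬c λ c → ¬oa (proj₁ (c r st)))
  ... | yes _  | no ¬ob = ⊥-elim (¬¬c λ c → ¬ob (proj₂ (c r st)))

  Compliant-fold : ∀ {a x s} → Compliant a (unfold x s) → Compliant a (μ x s)
  Compliant-fold {a} {x} {s} c = Compliant-coinduction P stuck step-P (inj₂ (refl , c))
    where
    P : Term → Term → Set
    P a b = Compliant a b ⊎ (b ≡ μ x s × Compliant a (unfold x s))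
    stuck : ∀ {a b} → P a b → Stuck a b → Ok a × Ok b
    stuck (inj₁ c)          st = Compliant-stuck c st
    stuck (inj₂ (refl , _)) st = ⊥-elim (st _ _ (right rec-τ))
    step-P : ∀ {a b a′ b′} → P a b → Step a b a′ b′ → P a′ b′
    step-P (inj₁ c)          st            = inj₁ (Compliant-step c st)
    step-P (inj₂ (refl , c)) (left t)      = inj₂ (refl , Compliant-step c (left t))
    step-P (inj₂ (refl , c)) (right rec-τ) = inj₁ c
    step-P (inj₂ (refl , c)) (sync _ () _)

  NoSync : Term → Term → Set
  NoSync a b = ∀ {λ₁ λ₂ a′ b′} → a —[ act λ₁ ]→ a′ → b —[ act λ₂ ]→ b′ → ¬ λ₁ ⋈ λ₂

  Compliant-forces-sync : ∀ {a b} → Compliant a b → ¬ Ok a → Stable a → Stable b → ¬ NoSync a b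
  Compliant-forces-sync c ¬ok sa sb no-sync = ¬ok (proj₁ (Compliant-stuck c stuck))
    where
    stuck : Stuck _ _
    stuck _ _ (left t)       = sa t
    stuck _ _ (right t)      = sb t
    stuck _ _ (sync t₁ t₂ m) = no-sync t₁ t₂ m

  co-⋈-?l : ∀ a {k} → co a ⋈ ?l k → a ≡ ?l k
  co-⋈-?l (?l _) ⋈-!? = refl

  -- s is deterministic unless it is an external sum, where the last hypothesis
  -- pins down the branch the test synchronises with.
  prefix-test : ∀ {a X s μ′ s′} → IsSC s → Compliant (prefix a X) s → s —[ act μ′ ]→ s′ →
                (IsExt s → ∀ {μ″ s″} → s —[ act μ″ ]→ s″ → a ⋈ μ″ → μ″ ≡ μ′) → Compliant X s′
  prefix-test {a} {X} {s} {μ′} {s′} p c t ext-match = Compliant-stable λ ¬c →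
    Compliant-forces-sync c prefix-¬Ok prefix-¬τ (act⇒¬τ t) (no-sync ¬c)
    where
    no-sync : ¬ Compliant X s′ → NoSync (prefix a X) s
    no-sync ¬c t₁ t₂ m with prefix-step⁻ t₁
    ... | refl , refl with act-deterministic t t₂
    ...   | inj₁ (refl , refl) = ¬c (Compliant-step c (sync t₁ t₂ m))
    ...   | inj₂ e with ext-match e t₂ m
    ...     | refl rewrite act-functional p t t₂ = ¬c (Compliant-step c (sync t₁ t₂ m))

  prefix-?l-test : ∀ {k k′ X s s′} → Compliant (prefix (?l k′) X) s → s —[ act (!l k) ]→ s′ → k ≡ k′
  prefix-?l-test {k} {k′} {X} {s} c t with k ≟ k′
  ... | yes k≡k′ = k≡k′
  ... | no k≢k′  = ⊥-elim (Compliant-forces-sync c prefix-¬Ok prefix-¬τ (act⇒¬τ t) no-sync)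
    where
    no-sync : NoSync (prefix (?l k′) X) s
    no-sync t₁ t₂ m with prefix-step⁻ t₁ | m
    ... | refl , refl | ⋈-?! with act-deterministic t t₂
    ...   | inj₁ (refl , _) = k≢k′ refl
    ...   | inj₂ e with IsExt-act⇒?l e t
    ...     | _ , ()

  IsSC-stepʳ : ∀ {a b a′ b′} → Step a b a′ b′ → IsSC b → IsSC b′
  IsSC-stepʳ (left t)       pb = pb
  IsSC-stepʳ (right t)      pb = IsSC-τ pb t
  IsSC-stepʳ (sync t₁ t₂ _) pb = IsSC-act pb t₂

  IsSC-stepˡ : ∀ {a b a′ b′} → Step a b a′ b′ → IsSC a → IsSC a′
  IsSC-stepˡ (left t)       pa = IsSC-τ pa t
  IsSC-stepˡ (right t)      pa = pa
  IsSC-stepˡ (sync t₁ t₂ _) pa = IsSC-act pa t₁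

  ⊨⇒Compliant : ∀ {ρ σ} → ρ ⊨ σ → Compliant (term ρ) (term σ)
  ⊨⇒Compliant {ρ} {σ} (R , isC , ρRσ) = Compliant-coinduction P stuck step-P (proj₂ ρ , proj₂ σ , ρRσ)
    where
    P : Term → Term → Set
    P a b = Σ (IsSC a) λ pa → Σ (IsSC b) λ pb → R (a , pa) (b , pb)
    stuck : ∀ {a b} → P a b → Stuck a b → Ok a × Ok b
    stuck (pa , pb , r) = proj₁ (isC _ _ r)
    step-P : ∀ {a b a′ b′} → P a b → Step a b a′ b′ → P a′ b′
    step-P (pa , pb , r) st = IsSC-stepˡ st pa , IsSC-stepʳ st pb , proj₂ (isC _ _ r) _ _ st

  Compliant⇒⊨ : ∀ {ρ σ} → Compliant (term ρ) (term σ) → ρ ⊨ σ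
  Compliant⇒⊨ c = (λ ρ σ → Compliant (term ρ) (term σ)) , (λ _ _ c → Compliant-stuck c , λ _ _ → Compliant-step c) , c

module Partners (BT : Set) (_≤:_ : BT → BT → Set) (≤:-refl : ∀ t → t ≤: t)
                      (B : Rel (Contracts.SC BT _≤:_) 0ℓ) (B-refl : ∀ σ → B σ σ) where
  open Contracts BT _≤:_
  open WithB B
  open Syntax BT _≤:_
  open Compliance BT _≤:_ B
  open Transitions BT _≤:_

  data Unfolds : Term → Term → Set where
    stop   : ∀ {t} → Unfolds t t
    unroll : ∀ {x s t} → Unfolds (unfold x s) t → Unfolds (μ x s) t

  Unfolds-snoc : ∀ {a x s} → Unfolds a (μ x s) → Unfolds a (unfold x s)
  Unfolds-snoc stop       = unroll stop
  Unfolds-snoc (unroll u) = unroll (Unfolds-snoc u)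

  NotRec : Term → Set
  NotRec (μ _ _) = ⊥
  NotRec _       = ⊤

  rec-or-NotRec : ∀ t → (Σ Var λ x → Σ Term λ s → t ≡ μ x s) ⊎ NotRec t
  rec-or-NotRec (μ x s)      = inj₁ (x , s , refl)
  rec-or-NotRec 𝟏            = inj₂ tt
  rec-or-NotRec (?b _ · _)   = inj₂ tt
  rec-or-NotRec (!b _ · _)   = inj₂ tt
  rec-or-NotRec (?h _ · _)   = inj₂ tt
  rec-or-NotRec (!h _ · _)   = inj₂ tt
  rec-or-NotRec (ext _ _ _)  = inj₂ tt
  rec-or-NotRec (int _ _ _)  = inj₂ tt
  rec-or-NotRec (var _)      = inj₂ tt

  Unfolds-NotRec : ∀ {a b} → NotRec a → Unfolds a b → a ≡ b
  Unfolds-NotRec _ stop = refl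

  act⇒NotRec : ∀ {t a t′} → t —[ act a ]→ t′ → NotRec t
  act⇒NotRec pre-?t      = tt
  act⇒NotRec pre-!t      = tt
  act⇒NotRec (pre-?σ _)  = tt
  act⇒NotRec (pre-!σ _)  = tt
  act⇒NotRec pre-!l      = tt
  act⇒NotRec (ext-?l _)  = tt

  NotRec-dual⁻ : ∀ b → NotRec (dual b) → NotRec b
  NotRec-dual⁻ 𝟏           _ = tt
  NotRec-dual⁻ (?b _ · _)  _ = tt
  NotRec-dual⁻ (!b _ · _)  _ = tt
  NotRec-dual⁻ (?h _ · _)  _ = tt
  NotRec-dual⁻ (!h _ · _)  _ = tt
  NotRec-dual⁻ (ext _ _ _) _ = tt
  NotRec-dual⁻ (int _ _ _) _ = tt
  NotRec-dual⁻ (var _)     _ = tt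

  UnfoldRelated : Term → Term → Set
  UnfoldRelated a b = Unfolds a b ⊎ Unfolds b a

  UnfoldRelated-unfoldˡ : ∀ {x s b} → UnfoldRelated (μ x s) b → UnfoldRelated (unfold x s) b
  UnfoldRelated-unfoldˡ (inj₁ stop)       = inj₂ (unroll stop)
  UnfoldRelated-unfoldˡ (inj₁ (unroll u)) = inj₁ u
  UnfoldRelated-unfoldˡ (inj₂ u)          = inj₂ (Unfolds-snoc u)

  UnfoldRelated-unfoldʳ : ∀ {x s a} → UnfoldRelated a (μ x s) → UnfoldRelated a (unfold x s)
  UnfoldRelated-unfoldʳ (inj₁ u)          = inj₁ (Unfolds-snoc u)
  UnfoldRelated-unfoldʳ (inj₂ stop)       = inj₁ (unroll stop)
  UnfoldRelated-unfoldʳ (inj₂ (unroll u)) = inj₂ u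

  UnfoldRelated-NotRecˡ : ∀ {a b} → NotRec a → UnfoldRelated a b → Unfolds b a
  UnfoldRelated-NotRecˡ n (inj₁ u) rewrite Unfolds-NotRec n u = stop
  UnfoldRelated-NotRecˡ n (inj₂ u) = u

  UnfoldRelated-NotRecʳ : ∀ {a b} → NotRec b → UnfoldRelated a b → Unfolds a b
  UnfoldRelated-NotRecʳ n (inj₁ u) = u
  UnfoldRelated-NotRecʳ n (inj₂ u) rewrite Unfolds-NotRec n u = stop

  B-reflexive : ∀ {t u} → t ≡ u → (p : IsSC t) (q : IsSC u) → B (t , p) (u , q)
  B-reflexive {t} refl p q rewrite T-irrelevant {isSC t} p q = B-refl (t , q)

  close-var-IsSC : ∀ q → IsSC q → IsSC (close var q)
  close-var-IsSC q p rewrite close-var q = p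

  dual-progress : ∀ b → IsSC b → NotRec b → Stuck (dual b) b → Ok (dual b) × Ok b
  dual-progress 𝟏 p n st = ok-𝟏 , ok-𝟏
  dual-progress (?b t · s) p n st = ⊥-elim (st _ _ (sync pre-!t pre-?t (⋈-!?t (≤:-refl t))))
  dual-progress (!b t · s) p n st = ⊥-elim (st _ _ (sync pre-?t pre-!t (⋈-?!t (≤:-refl t))))
  dual-progress (?h q · s) p n st =
    ⊥-elim (st _ _ (sync (pre-!σ (close-var-IsSC q pq)) (pre-?σ pq) (⋈-!?σ (B-reflexive (close-var q) _ pq))))
    where
    pq : IsSC q
    pq = IsSC-payload-in {q} {s} p
  dual-progress (!h q · s) p n st =
    ⊥-elim (st _ _ (sync (pre-?σ (close-var-IsSC q pq)) (pre-!σ pq) (⋈-?!σ (B-reflexive (sym (close-var q)) pq _))))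
    where
    pq : IsSC q
    pq = IsSC-payload-out {q} {s} p
  dual-progress (ext l s [])      p n st = ⊥-elim (st _ _ (sync pre-!l (ext-?l (here refl)) ⋈-!?))
  dual-progress (ext l s (_ ∷ _)) p n st = ⊥-elim (st _ _ (left (int-τ (here refl))))
  dual-progress (int l s [])      p n st = ⊥-elim (st _ _ (sync (ext-?l (here refl)) pre-!l ⋈-?!))
  dual-progress (int l s (_ ∷ _)) p n st = ⊥-elim (st _ _ (right (int-τ (here refl))))

  -- The configurations reachable from  dual b ∣ b : up to pending unfoldings
  -- the two sides mirror each other, except right after an internal choice,
  -- when the chooser has committed and its partner still offers the sum.
  data DualState (a b : Term) : Set where
    mirror   : ∀ b₁ → IsSC b₁ → a ≡ dual b₁ → UnfoldRelated b₁ b → DualState a b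
    chose    : ∀ l s ls k c → IsSC (ext l s ls) → Unfolds b (ext l s ls) → (k , c) ∈ ((l , s) ∷ ls) →
               a ≡ int k (dual c) [] → DualState a b
    awaiting : ∀ b₁ l s ls k c → IsSC b₁ → IsSC (int l s ls) → Unfolds b₁ (int l s ls) → a ≡ dual b₁ →
               b ≡ int k c [] → (k , c) ∈ ((l , s) ∷ ls) → DualState a b

  DualState-stuck : ∀ {a b} → DualState a b → Stuck a b → Ok a × Ok b
  DualState-stuck (mirror b₁ p refl rel) st with rec-or-NotRec b₁
  ... | inj₁ (x , s , refl) = ⊥-elim (st _ _ (left rec-τ))
  ... | inj₂ n with UnfoldRelated-NotRecˡ n rel
  ...   | stop     = dual-progress b₁ p n st
  ...   | unroll _ = ⊥-elim (st _ _ (right rec-τ))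
  DualState-stuck (chose l s ls k c p stop m refl) st = ⊥-elim (st _ _ (sync pre-!l (ext-?l m) ⋈-!?))
  DualState-stuck (chose l s ls k c p (unroll _) m refl) st = ⊥-elim (st _ _ (right rec-τ))
  DualState-stuck (awaiting b₁ l s ls k c _ _ stop refl refl m) st =
    ⊥-elim (st _ _ (sync (ext-?l (∈-dualᴱL⁺ ((l , s) ∷ ls) m)) pre-!l ⋈-?!))
  DualState-stuck (awaiting b₁ l s ls k c _ _ (unroll _) refl refl m) st = ⊥-elim (st _ _ (left rec-τ))

  DualState-left : ∀ {a′ b} b₁ → IsSC b₁ → UnfoldRelated b₁ b → dual b₁ —[ τ ]→ a′ → DualState a′ b
  DualState-left (μ x s) p rel rec-τ =
    mirror (unfold x s) (IsSC-unfold {x} {s} p) (dual-unfold x s p) (UnfoldRelated-unfoldˡ rel)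
  DualState-left (ext l s (q ∷ ls)) p rel (int-τ m) with ∈-dualᴱL⁻ ((l , s) ∷ q ∷ ls) m
  ... | c , m′ , refl = chose l s (q ∷ ls) _ c p (UnfoldRelated-NotRecˡ tt rel) m′ refl

  DualState-sync : ∀ {a′ b′ λ₁ λ₂} b₁ → IsSC b₁ → dual b₁ —[ act λ₁ ]→ a′ → b₁ —[ act λ₂ ]→ b′ →
                   DualState a′ b′
  DualState-sync b₁ p t₁ t₂ = mirror _ (IsSC-act p t₂) (continuation t₁ t₂) (inj₁ stop)
    where
    continuation : ∀ {a′ b′ λ₁ λ₂ b₁} → dual b₁ —[ act λ₁ ]→ a′ → b₁ —[ act λ₂ ]→ b′ → a′ ≡ dual b′
    continuation {b₁ = ?b t · s}     pre-!t          pre-?t          = refl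
    continuation {b₁ = !b t · s}     pre-?t          pre-!t          = refl
    continuation {b₁ = ?h q · s}     (pre-!σ _)      (pre-?σ _)      = refl
    continuation {b₁ = !h q · s}     (pre-?σ _)      (pre-!σ _)      = refl
    continuation {b₁ = ext l s []}   pre-!l          (ext-?l (here refl)) = refl
    continuation {b₁ = int l s []}   (ext-?l (here refl)) pre-!l     = refl

  DualState-step : ∀ {a b a′ b′} → IsSC b → DualState a b → Step a b a′ b′ → DualState a′ b′
  DualState-step pb (mirror b₁ p refl rel) (left t) = DualState-left b₁ p rel t
  DualState-step pb (mirror b₁ p refl rel) (right rec-τ) = mirror b₁ p refl (UnfoldRelated-unfoldʳ rel)
  DualState-step pb (mirror b₁ p refl rel) (right (int-τ m)) =
    awaiting b₁ _ _ _ _ _ p pb (UnfoldRelated-NotRecʳ tt rel) refl refl m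
  DualState-step pb (mirror b₁ p refl rel) (sync t₁ t₂ _)
    with Unfolds-NotRec (act⇒NotRec t₂) (UnfoldRelated-NotRecˡ (NotRec-dual⁻ b₁ (act⇒NotRec t₁)) rel)
  ... | refl = DualState-sync b₁ p t₁ t₂
  DualState-step pb (chose l s ls k c p (unroll u) m refl) (right rec-τ) = chose l s ls k c p u m refl
  DualState-step pb (chose l s ls k c p stop m refl) (sync pre-!l (ext-?l m′) ⋈-!?)
    rewrite distinct-∈-unique ((l , s) ∷ ls) (distinct-ext {l} {s} {ls} p) m′ m =
    mirror c (IsSC-ext-branch {l} {s} {ls} p m) refl (inj₁ stop)
  DualState-step pb (awaiting (μ x s′) l s ls k c p₁ p (unroll u) refl refl m) (left rec-τ) =
    awaiting (unfold x s′) l s ls k c (IsSC-unfold {x} {s′} p₁) p u (dual-unfold x s′ p₁) refl m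
  DualState-step pb (awaiting _ l s ls k c p₁ p stop refl refl m) (sync (ext-?l m₁) pre-!l ⋈-?!)
    with ∈-dualᴱL⁻ ((l , s) ∷ ls) m₁
  ... | c′ , m₁′ , refl rewrite distinct-∈-unique ((l , s) ∷ ls) (distinct-int {l} {s} {ls} p) m₁′ m =
    mirror c (IsSC-int-branch {l} {s} {ls} p m) refl (inj₁ stop)

  dual-compliant : ∀ b → IsSC b → Compliant (dual b) b
  dual-compliant b p = Compliant-coinduction P stuck step-P (mirror b p refl (inj₁ stop) , p)
    where
    P : Term → Term → Set
    P a b = DualState a b × IsSC b
    stuck : ∀ {a b} → P a b → Stuck a b → Ok a × Ok b
    stuck (d , _) = DualState-stuck d
    step-P : ∀ {a b a′ b′} → P a b → Step a b a′ b′ → P a′ b′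
    step-P (d , pb) st = DualState-step pb d st , IsSC-stepʳ st pb

  co-⋈ : ∀ a → co a ⋈ a
  co-⋈ (?l k) = ⋈-!?
  co-⋈ (!l k) = ⋈-?!
  co-⋈ (?t t) = ⋈-!?t (≤:-refl t)
  co-⋈ (!t t) = ⋈-?!t (≤:-refl t)
  co-⋈ (?σ d) = ⋈-!?σ (B-refl d)
  co-⋈ (!σ d) = ⋈-?!σ (B-refl d)

  prefix-compliant : ∀ {s α c X} → IsSC s → Stable s → s —[ act α ]→ c → Compliant X c →
                     Compliant (prefix (co α) X) s
  prefix-compliant {α = α} {X = X} p stable t c =
    Compliant-intro (λ st → ⊥-elim (st _ _ (sync (prefix-step (co α) X) t (co-⋈ α)))) continue
    where
    continue : ∀ {a′ b′} → Step (prefix (co α) X) _ a′ b′ → Compliant a′ b′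
    continue (left t′)  = ⊥-elim (prefix-¬τ t′)
    continue (right t′) = ⊥-elim (stable t′)
    continue (sync t₁ t₂ m) with prefix-step⁻ t₁
    ... | refl , refl with act-deterministic t t₂
    ...   | inj₁ (refl , refl) = c
    ...   | inj₂ e with IsExt-act⇒?l e t₂
    ...     | _ , refl with co-⋈-?l α m
    ...       | refl rewrite act-functional p t₂ t = c

  reply : Label → Term → Label × Term → Label × Term
  reply k ρ (i , c) = i , (if i ≡ᵇ k then ρ else dual c)

  responder : Label → Term → Label → Term → List (Label × Term) → Term
  responder k ρ l s ls = ext l (proj₂ (reply k ρ (l , s))) (map (reply k ρ) ls)

  IsSC-responder : ∀ k ρ l s ls → IsSC (int l s ls) → IsSC ρ → IsSC (responder k ρ l s ls)
  IsSC-responder k ρ l s ls p pρ = IsSC-intro (responder k ρ l s ls)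
    (ClosedL-∀ (map (reply k ρ) ((l , s) ∷ ls)) (λ {_} {d} m → IsSC⇒Closed d (IsSC-reply m)))
    (∧-intro distinct-labels (WFL-∀ (map (reply k ρ) ((l , s) ∷ ls)) (λ {_} {d} m → IsSC⇒WF d (IsSC-reply m))))
    where
    distinct-labels : distinct (labels l (map (reply k ρ) ls)) ≡ true
    distinct-labels rewrite sym (map-∘ {g = proj₁} {f = reply k ρ} ls) = distinct-int {l} {s} {ls} p
    IsSC-reply : ∀ {i d} → (i , d) ∈ map (reply k ρ) ((l , s) ∷ ls) → IsSC d
    IsSC-reply m with ∈-map⁻ (reply k ρ) m
    ... | (i , c) , mc , refl with i ≡ᵇ k
    ...   | true  = pρ
    ...   | false = IsSC-dual c (IsSC-int-branch {l} {s} {ls} p mc)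

  responder-compliant : ∀ {l s q ls k c ρ} → IsSC (int l s (q ∷ ls)) → (k , c) ∈ ((l , s) ∷ q ∷ ls) →
                        Compliant ρ c → Compliant (responder k ρ l s (q ∷ ls)) (int l s (q ∷ ls))
  responder-compliant {l} {s} {q} {ls} {k} {c} {ρ} p m cρ =
    Compliant-intro (λ st → ⊥-elim (st _ _ (right (int-τ (here refl))))) after-τ
    where
    bs : List (Label × Term)
    bs = (l , s) ∷ q ∷ ls
    R : Term
    R = responder k ρ l s (q ∷ ls)
    unique : ∀ {i d d′} → (i , d) ∈ bs → (i , d′) ∈ bs → d ≡ d′
    unique = distinct-∈-unique bs (distinct-int {l} {s} {q ∷ ls} p)
    after-choice : ∀ {i d} → (i , d) ∈ bs → Compliant R (int i d [])
    after-choice {i} {d} mi =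
      Compliant-intro (λ st → ⊥-elim (st _ _ (sync (ext-?l (∈-map⁺ (reply k ρ) mi)) pre-!l ⋈-?!))) answer
      where
      answer : ∀ {a′ b′} → Step R (int i d []) a′ b′ → Compliant a′ b′
      answer (sync (ext-?l m′) pre-!l ⋈-?!) with ∈-map⁻ (reply k ρ) m′
      ... | (i , d′) , md′ , refl rewrite unique md′ mi with i ≡ᵇ k | ≡ᵇ-reflects i k
      ...   | true  | ofʸ refl rewrite unique m mi = cρ
      ...   | false | _        = dual-compliant d (IsSC-int-branch {l} {s} {q ∷ ls} p mi)
    after-τ : ∀ {a′ b′} → Step R (int l s (q ∷ ls)) a′ b′ → Compliant a′ b′
    after-τ (right (int-τ mi)) = after-choice mi

module Monotonicity (BT : Set) (_≤:_ : BT → BT → Set)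
    (≤:-refl : ∀ t → t ≤: t) (≤:-trans : ∀ {t₁ t₂ t₃} → t₁ ≤: t₂ → t₂ ≤: t₃ → t₁ ≤: t₃)
    (B B′ : Rel (Contracts.SC BT _≤:_) 0ℓ) (B-refl : ∀ σ → B σ σ)
    (B′-trans : ∀ {σ₁ σ₂ σ₃} → B′ σ₁ σ₂ → B′ σ₂ σ₃ → B′ σ₁ σ₃) (B⇒B′ : B ⇒ B′) where
  open Contracts BT _≤:_
  open Syntax BT _≤:_
  open Transitions BT _≤:_
  open WithB B
  open Compliance BT _≤:_ B
  open Partners BT _≤:_ ≤:-refl B B-refl
  module W′ = WithB B′
  module C′ = Compliance BT _≤:_ B′

  ⋈-transfer : ∀ {λ₁ a λ₂} → λ₁ W′.⋈ a → co a ⋈ λ₂ → λ₁ W′.⋈ λ₂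
  ⋈-transfer W′.⋈-!?       ⋈-!?       = W′.⋈-!?
  ⋈-transfer W′.⋈-?!       ⋈-?!       = W′.⋈-?!
  ⋈-transfer (W′.⋈-!?t t₁≤) (⋈-!?t ≤t₂) = W′.⋈-!?t (≤:-trans t₁≤ ≤t₂)
  ⋈-transfer (W′.⋈-?!t ≤t₁) (⋈-?!t t₂≤) = W′.⋈-?!t (≤:-trans t₂≤ ≤t₁)
  ⋈-transfer (W′.⋈-!?σ σ₁B′) (⋈-!?σ σB)  = W′.⋈-!?σ (B′-trans σ₁B′ (B⇒B′ σB))
  ⋈-transfer (W′.⋈-?!σ σ₁B′) (⋈-?!σ σB)  = W′.⋈-?!σ (B′-trans (B⇒B′ σB) σ₁B′)

  _⊑_ : Term → Term → Set
  σ₁ ⊑ σ₂ = ∀ (ρ : SC) → Compliant (term ρ) σ₁ → Compliant (term ρ) σ₂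

  Peer⇒⊑ : ∀ {σ₁ σ₂} → Peer B σ₁ σ₂ → term σ₁ ⊑ term σ₂
  Peer⇒⊑ σ₁⊑σ₂ ρ c = ⊨⇒Compliant (σ₁⊑σ₂ ρ (Compliant⇒⊨ c))

  prefix-SC : Act → (ρ : SC) → SC
  prefix-SC a (ρ , p) = prefix a ρ , IsSC-prefix a ρ p

  Mediated : Term → Term → Set
  Mediated r s₂ = Σ Term λ s₁ → IsSC s₁ × C′.Compliant r s₁ × s₁ ⊑ s₂

  module _ {r s₂ : Term} (pr : IsSC r) (p₂ : IsSC s₂) where

    StuckOk : Set
    StuckOk = W′.Stuck r s₂ → Ok r × Ok s₂

    SyncMediated : Set
    SyncMediated = ∀ {λ₁ λ₂ r′ s₂′} → r —[ act λ₁ ]→ r′ → s₂ —[ act λ₂ ]→ s₂′ → λ₁ W′.⋈ λ₂ →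
                   Mediated r′ s₂′

    -- Were r ∣ s₂ stuck, the dual of any synchronisation of r ∣ s₁ would be a
    -- B-partner of s₁, hence of s₂, and ⋈-transfer would let r synchronise with s₂.
    stable-not-stuck : ∀ {s₁} → IsSC s₁ → Stable s₁ → ¬ Ok s₁ → C′.Compliant r s₁ → s₁ ⊑ s₂ →
                       ¬ W′.Stuck r s₂
    stable-not-stuck {s₁} p₁ stable₁ ¬ok cr sub st = ¬ok (proj₂ (C′.Compliant-stuck cr stuck₁))
      where
      stuck₁ : W′.Stuck r s₁
      stuck₁ _ _ (W′.left t)  = st _ _ (W′.left t)
      stuck₁ _ _ (W′.right t) = stable₁ t
      stuck₁ _ d (W′.sync {λ₂ = β} t₁ t₂ m) =
        Compliant-forces-sync test prefix-¬Ok prefix-¬τ (λ t → st _ _ (W′.right t)) no-sync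
        where
        pd : IsSC d
        pd = IsSC-act p₁ t₂
        test : Compliant (prefix (co β) (dual d)) s₂
        test = sub (prefix-SC (co β) (dual d , IsSC-dual d pd)) (prefix-compliant p₁ stable₁ t₂ (dual-compliant d pd))
        no-sync : NoSync (prefix (co β) (dual d)) s₂
        no-sync t₁′ t₂′ m′ with prefix-step⁻ t₁′
        ... | refl , refl = st _ _ (W′.sync t₁ t₂′ (⋈-transfer m m′))

    one-compliant : Compliant 𝟏 𝟏
    one-compliant = Compliant-intro (λ _ → ok-𝟏 , ok-𝟏) λ { (left ()) ; (right ()) ; (sync () _ _) }

    one-stuck : C′.Compliant r 𝟏 → 𝟏 ⊑ s₂ → StuckOk
    one-stuck cr sub st = proj₁ (C′.Compliant-stuck cr stuck₁) , proj₂ (Compliant-stuck (sub (𝟏 , tt) one-compliant) stuck₂)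
      where
      stuck₁ : W′.Stuck r 𝟏
      stuck₁ _ _ (W′.left t)     = st _ _ (W′.left t)
      stuck₁ _ _ (W′.sync _ () _)
      stuck₂ : Stuck 𝟏 s₂
      stuck₂ _ _ (right t)    = st _ _ (W′.right t)
      stuck₂ _ _ (sync () _ _)

    one-no-sync : ∀ {λ₁ r′} → C′.Compliant r 𝟏 → ¬ (r —[ act λ₁ ]→ r′)
    one-no-sync cr t = act⇒¬Ok t (proj₁ (C′.Compliant-stuck cr stuck₁))
      where
      stuck₁ : W′.Stuck r 𝟏
      stuck₁ _ _ (W′.left t′)    = act⇒¬τ t t′
      stuck₁ _ _ (W′.sync _ () _)

    -- s₁ has a single transition s₁ —α→ c: the synchronisation of r with s₂ is
    -- matched by s₁ —α→ c, since prefix tests  co α.X  for s₁ also pass s₂.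
    single-sync : ∀ {s₁ α c} → IsSC s₁ → ¬ IsExt s₁ → s₁ —[ act α ]→ c → C′.Compliant r s₁ → s₁ ⊑ s₂ →
                  SyncMediated
    single-sync {s₁} {α} {c} p₁ ¬ext tα cr sub {λ₁} {λ₂} {r′} {s₂′} t_r t_s m =
      c , pc , r′-compliant , c⊑s₂′
      where
      pc : IsSC c
      pc = IsSC-act p₁ tα
      test : ∀ X → IsSC X → Compliant X c → Compliant (prefix (co α) X) s₂
      test X pX cX = sub (prefix-SC (co α) (X , pX)) (prefix-compliant p₁ (act⇒¬τ tα) tα cX)
      c⊑s₂′ : c ⊑ s₂′
      c⊑s₂′ (X , pX) cX = prefix-test p₂ (test X pX cX) t_s ext-match
        where
        ext-match : IsExt s₂ → ∀ {μ″ s″} → s₂ —[ act μ″ ]→ s″ → co α ⋈ μ″ → μ″ ≡ λ₂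
        ext-match e t″ m″ with IsExt-act⇒?l e t″
        ... | _ , refl with co-⋈-?l α m″
        ...   | refl = ⊥-elim (¬ext (?l⇒IsExt tα))
      -- When r is an external sum, the prefix test ?k₁.dual c pins down the
      -- label of the output of s₂.
      same-continuation : ∀ {a r₁} → r —[ act a ]→ r₁ → a W′.⋈ α → λ₁ W′.⋈ λ₂ → r₁ ≡ r′
      same-continuation t₁ m₁ m with act-deterministic t_r t₁
      ... | inj₁ (refl , r′≡r₁) = sym r′≡r₁
      ... | inj₂ e with IsExt-act⇒?l e t_r | IsExt-act⇒?l e t₁ | m | m₁
      ...   | k , refl | k₁ , refl | W′.⋈-?! | W′.⋈-?! with prefix-?l-test (test (dual c) (IsSC-dual c pc) (dual-compliant c pc)) t_s
      ...     | refl = act-functional pr t₁ t_r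
      r′-compliant : C′.Compliant r′ c
      r′-compliant = C′.Compliant-stable λ ¬c → act⇒¬Ok tα (proj₂ (C′.Compliant-stuck cr (stuck₁ ¬c)))
        where
        stuck₁ : ¬ C′.Compliant r′ c → W′.Stuck r s₁
        stuck₁ ¬c _ _ (W′.left t)  = act⇒¬τ t_r t
        stuck₁ ¬c _ _ (W′.right t) = act⇒¬τ tα t
        stuck₁ ¬c _ _ (W′.sync t₁ t₂ m₁) with act-deterministic tα t₂
        ... | inj₂ e = ¬ext e
        ... | inj₁ (refl , refl) =
          ¬c (transport (λ x → C′.Compliant x c) (same-continuation t₁ m₁ m) (C′.Compliant-step cr (W′.sync t₁ t₂ m₁)))

    ext-partner-outputs : ∀ {l s ls a r′} → C′.Compliant r (ext l s ls) → r —[ act a ]→ r′ →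
                          IsOutputOf a ((l , s) ∷ ls)
    ext-partner-outputs {l} {s} {ls} {a} cr t_r with isOutputOf? a ((l , s) ∷ ls)
    ... | yes o  = o
    ... | no ¬o = ⊥-elim (ext-¬Ok (proj₂ (C′.Compliant-stuck cr stuck₁)))
      where
      ext-¬Ok : ¬ Ok (ext l s ls)
      ext-¬Ok ()
      stuck₁ : W′.Stuck r (ext l s ls)
      stuck₁ _ _ (W′.left t) = act⇒¬τ t_r t
      stuck₁ _ _ (W′.sync t₁ (ext-?l mc) W′.⋈-!?) with act-deterministic t_r t₁
      ... | inj₁ (refl , _) = ¬o (_ , _ , refl , mc)
      ... | inj₂ e with IsExt-act⇒?l e t₁
      ...   | _ , ()

    ext-sync : ∀ {l s ls} → IsSC (ext l s ls) → C′.Compliant r (ext l s ls) → ext l s ls ⊑ s₂ → SyncMediated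
    ext-sync {l} {s} {ls} p cr sub t_r t_s m with ext-partner-outputs cr t_r | m
    ... | k , c , refl , mc | W′.⋈-!? =
      c , IsSC-ext-branch {l} {s} {ls} p mc , C′.Compliant-step cr (W′.sync t_r (ext-?l mc) W′.⋈-!?) , c⊑s₂′
      where
      c⊑s₂′ : c ⊑ _
      c⊑s₂′ X cX = prefix-test p₂ (sub (prefix-SC (!l k) X) (prefix-compliant p (λ ()) (ext-?l mc) cX)) t_s ext-match
        where
        ext-match : IsExt s₂ → ∀ {μ″ s″} → s₂ —[ act μ″ ]→ s″ → !l k ⋈ μ″ → μ″ ≡ ?l k
        ext-match _ _ ⋈-!? = refl

    module _ {l s q ls} (p : IsSC (int l s (q ∷ ls))) (cr : C′.Compliant r (int l s (q ∷ ls)))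
             (sub : int l s (q ∷ ls) ⊑ s₂) where

      branches : List (Label × Term)
      branches = (l , s) ∷ q ∷ ls

      all-duals-test : Compliant (responder l (dual s) l s (q ∷ ls)) s₂
      all-duals-test = sub (_ , IsSC-responder l (dual s) l s (q ∷ ls) p (IsSC-dual s ps))
                           (responder-compliant p (here refl) (dual-compliant s ps))
        where
        ps : IsSC s
        ps = IsSC-int-branch {l} {s} {q ∷ ls} p (here refl)

      s₂-outputs-a-branch : Stable s₂ → ¬ (∀ {i d y} → (i , d) ∈ branches → ¬ (s₂ —[ act (!l i) ]→ y))
      s₂-outputs-a-branch stable₂ h = Compliant-forces-sync all-duals-test (λ ()) (λ ()) stable₂ no-sync
        where
        no-sync : NoSync (responder l (dual s) l s (q ∷ ls)) s₂
        no-sync (ext-?l m′) t₂ ⋈-?! with ∈-map⁻ (reply l (dual s)) m′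
        ... | _ , md , refl = h md t₂

      int-not-stuck : StuckOk
      int-not-stuck st = ⊥-elim (s₂-outputs-a-branch (λ t → st _ _ (W′.right t)) refuse)
        where
        refuse : ∀ {i d y} → (i , d) ∈ branches → ¬ (s₂ —[ act (!l i) ]→ y)
        refuse {i} {d} mi t₂ = int-¬Ok (proj₂ (C′.Compliant-stuck (C′.Compliant-step cr (W′.right (int-τ mi))) stuck₁))
          where
          int-¬Ok : ¬ Ok (int i d [])
          int-¬Ok ()
          stuck₁ : W′.Stuck r (int i d [])
          stuck₁ _ _ (W′.left t) = st _ _ (W′.left t)
          stuck₁ _ _ (W′.sync t₁ pre-!l W′.⋈-?!) = st _ _ (W′.sync t₁ t₂ W′.⋈-?!)

      int-sync : SyncMediated
      int-sync {λ₂ = λ₂} t_r t_s m with isOutputOf? λ₂ branches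
      ... | no ¬o = ⊥-elim (s₂-outputs-a-branch (act⇒¬τ t_s) λ mi t → ¬o (_ , _ , proj₁ (!l-determines t_s t) , mi))
      ... | yes (k , c , refl , mc) =
        c , IsSC-int-branch {l} {s} {q ∷ ls} p mc ,
        C′.Compliant-step (C′.Compliant-step cr (W′.right (int-τ mc))) (W′.sync t_r pre-!l m) , c⊑s₂′
        where
        c⊑s₂′ : c ⊑ _
        c⊑s₂′ (X , pX) cX = transport (λ x → Compliant x _) chosen
          (Compliant-step (sub (_ , IsSC-responder k X l s (q ∷ ls) p pX) (responder-compliant p mc cX))
                          (sync (ext-?l (∈-map⁺ (reply k X) mc)) t_s ⋈-?!))
          where
          chosen : (if k ≡ᵇ k then X else dual c) ≡ X
          chosen rewrite ≡ᵇ-refl k = refl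

    single-transfers : ∀ {s₁ α c} → IsSC s₁ → ¬ IsExt s₁ → s₁ —[ act α ]→ c → C′.Compliant r s₁ → s₁ ⊑ s₂ →
                       StuckOk × SyncMediated
    single-transfers p₁ ¬ext tα cr sub =
      (λ st → ⊥-elim (stable-not-stuck p₁ (act⇒¬τ tα) (act⇒¬Ok tα) cr sub st)) , single-sync p₁ ¬ext tα cr sub

    mediated-transfers : ∀ n s₁ → μ-depth s₁ ≤ n → IsSC s₁ → C′.Compliant r s₁ → s₁ ⊑ s₂ →
                         StuckOk × SyncMediated
    mediated-transfers n 𝟏 _ _ cr sub = one-stuck cr sub , λ t_r _ _ → ⊥-elim (one-no-sync cr t_r)
    mediated-transfers (suc n) (μ x s) (s≤s d≤n) p cr sub =
      mediated-transfers n (unfold x s) (transport (_≤ n) (sym (μ-depth-unfold {x} {s} p)) d≤n) (IsSC-unfold {x} {s} p)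
        (C′.Compliant-step cr (W′.right rec-τ)) (λ ρ c → sub ρ (Compliant-fold c))
    mediated-transfers n (ext l s ls) _ p cr sub =
      (λ st → ⊥-elim (stable-not-stuck p (λ ()) (λ ()) cr sub st)) , ext-sync p cr sub
    mediated-transfers n (int l s (q ∷ ls)) _ p cr sub = int-not-stuck p cr sub , int-sync p cr sub
    mediated-transfers n (int l s []) _ p cr sub = single-transfers p (λ ()) pre-!l cr sub
    mediated-transfers n (?b t · s) _ p cr sub = single-transfers p (λ ()) pre-?t cr sub
    mediated-transfers n (!b t · s) _ p cr sub = single-transfers p (λ ()) pre-!t cr sub
    mediated-transfers n (?h q · s) _ p cr sub = single-transfers p (λ ()) (pre-?σ (IsSC-payload-in {q} {s} p)) cr sub
    mediated-transfers n (!h q · s) _ p cr sub = single-transfers p (λ ()) (pre-!σ (IsSC-payload-out {q} {s} p)) cr sub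

  Mediated-isCompliance : W′.IsCompliance (λ ρ σ → Mediated (term ρ) (term σ))
  Mediated-isCompliance (r , pr) (s₂ , p₂) (s₁ , p₁ , cr , sub) = proj₁ transfers , steps
    where
    transfers : StuckOk pr p₂ × SyncMediated pr p₂
    transfers = mediated-transfers pr p₂ (μ-depth s₁) s₁ ≤-refl p₁ cr sub
    steps : ∀ ρ′ σ′ → W′.Step r s₂ (term ρ′) (term σ′) → Mediated (term ρ′) (term σ′)
    steps _ _ (W′.left t)       = s₁ , p₁ , C′.Compliant-step cr (W′.left t) , sub
    steps _ _ (W′.right t)      = s₁ , p₁ , cr , λ ρ c → Compliant-step (sub ρ c) (right t)
    steps _ _ (W′.sync t₁ t₂ m) = proj₂ transfers t₁ t₂ m

  Peer-mono : Peer B ⇒ Peer B′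
  Peer-mono {σ₁} {σ₂} σ₁⊑σ₂ ρ ρ⊨σ₁ =
    _ , Mediated-isCompliance , term σ₁ , proj₂ σ₁ , C′.⊨⇒Compliant ρ⊨σ₁ , Peer⇒⊑ σ₁⊑σ₂

Peer-isPreorder : (BT : Set) (_≤:_ : BT → BT → Set) (B : Rel (Contracts.SC BT _≤:_) 0ℓ) →
                  IsPreorder _≡_ (Contracts.Peer BT _≤:_ B)
Peer-isPreorder BT _≤:_ B = record
  { isEquivalence = isEquivalence
  ; reflexive     = λ { refl ρ ρ⊨σ → ρ⊨σ }
  ; trans         = λ σ₁⊑σ₂ σ₂⊑σ₃ ρ ρ⊨σ₁ → σ₂⊑σ₃ ρ (σ₁⊑σ₂ ρ ρ⊨σ₁)
  }

proposition4p3 : (BT : Set) (_≤:_ : BT → BT → Set) → IsPreorder _≡_ _≤:_ →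
    ((B : Rel (Contracts.SC BT _≤:_) 0ℓ) → IsPreorder _≡_ B →
      IsPreorder _≡_ (Contracts.Peer BT _≤:_ B))
    × ((B B′ : Rel (Contracts.SC BT _≤:_) 0ℓ) → IsPreorder _≡_ B → IsPreorder _≡_ B′ →
      B ⇒ B′ → Contracts.Peer BT _≤:_ B ⇒ Contracts.Peer BT _≤:_ B′)
proposition4p3 BT _≤:_ ≤:-pre =
    (λ B _ → Peer-isPreorder BT _≤:_ B)
  , (λ B B′ B-pre B′-pre →
       Monotonicity.Peer-mono BT _≤:_ (λ t → IsPreorder.refl ≤:-pre {t}) (IsPreorder.trans ≤:-pre)
         B B′ (λ σ → IsPreorder.refl B-pre {σ}) (IsPreorder.trans B′-pre))
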